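{- For every integer $n\ge2$, $$\Delta(n)\ll\frac{\tau(n)}{\sqrt{\Omega_2(n)}},$$ with an absolute implied constant.
   Context: $\tau(n)$ is the number of positive divisors of $n$, $\Omega_2(n):=\sum_{p^v\| n}v^2$, and $\Delta(n):=\max_{u\in\mathbb{R}}|\{d\mid n:\ e^u<d\le e^{u+1}\}|$ is the Erdős–Hooley Delta function. -}

module Defs where

open import Data.Nat using (ℕ; zero; suc; _+_; _*_; _^_; _≤_; _<_)
open import Data.Nat using (_!)
open import Data.Nat.Divisibility using (_∣_; _∣?_)
open import Data.Nat.Primality using (prime?)
open import Data.List using (List; length; filter; map; upTo)
open import Data.Nat.ListAction using (sum)
open import Data.Product using (_×_; ∃)

range1 : ℕ → List ℕ
range1 n = map suc (upTo n)

τ : ℕ → ℕ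
τ n = length (filter (_∣? n) (range1 n))

-- v_p(n) for n ≥ 1, p ≥ 2: the number of k ∈ {1,…,n} with p^k ∣ n
-- (equals the exponent v with p^v ∥ n, since v ≤ n).
val : ℕ → ℕ → ℕ
val p n = length (filter (λ k → (p ^ k) ∣? n) (range1 n))

Ω₂ : ℕ → ℕ
Ω₂ n = sum (map (λ p → val p n * val p n) (filter prime? (range1 n)))

-- eNum k = Σ_{j=0}^{k} k!/j!, so eNum k / k! is the k-th partial sum of Σ 1/j! = e.
eNum : ℕ → ℕ
eNum zero    = 1
eNum (suc k) = suc k * eNum k + 1

-- x < e·d, for naturals x, d: some partial sum of the series for e exceeds x/d
-- (the partial sums increase strictly to e).
LtETimes : ℕ → ℕ → Set
LtETimes x d = ∃ λ k → x * (k !) < d * eNum k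

InWindow : ℕ → ℕ → ℕ → Set
InWindow n d x = (x ∣ n) × (d ≤ x) × LtETimes x d

-- Write n = ∏ pᵢ ^ vᵢ. Its divisors form the product of the chains 1 < pᵢ < ⋯ < pᵢ ^ vᵢ,
-- which is covered by symmetric chains (de Bruijn, Tengbergen and Kruyswijk), built one
-- prime at a time from nested hooks. Every chain passes through the middle rank ⌊Ω(n)/2⌋,
-- so there are at most N chains, N being the middle coefficient of ∏ (1 + x + ⋯ + x^vᵢ);
-- consecutive divisors in a chain differ by a prime factor, so a chain meets a window
-- [d, e d) at most twice, and the window holds at most 2N divisors. The coefficients of
-- ∏ (1 + x + ⋯ + x^vᵢ) form a log-concave sequence with total τ(n) and variance
-- ∑ vᵢ (vᵢ + 2) / 12 ≥ Ω₂(n) / 12, and a log-concave sequence decays geometrically away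
-- from its centre, so N² Ω₂(n) ≪ τ(n)².

module Submission where

open import Defs
open import Data.Nat using (ℕ; _*_; _^_; _≤_)
open import Data.Nat.Divisibility using (_∣_)
open import Data.List using (List; length)
open import Data.List.Relation.Unary.All using (All)
open import Data.List.Relation.Unary.Unique.Propositional using (Unique)
open import Data.Product using (∃)

open import Data.Nat.Base
open import Data.Nat.Properties
open import Data.Nat.Divisibility
open import Data.Nat.Primality
open import Data.Nat.Primality.Factorisation using (factorise)
open import Data.Nat.Coprimality using (Coprime; coprime-divisor)
open import Data.Nat.Induction using (<-wellFounded)
open import Data.Nat.ListAction using (sum; product)
open import Data.Nat.Tactic.RingSolver using (solve-∀)
open import Algebra.Properties.CommutativeSemigroup +-commutativeSemigroup using () renaming (interchange to +-interchange; x∙yz≈y∙xz to x+[y+z]≡y+[x+z])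
open import Algebra.Properties.CommutativeSemigroup *-commutativeSemigroup using () renaming (x∙yz≈y∙xz to x*[y*z]≡y*[x*z]; x∙yz≈xz∙y to x*[y*z]≡x*z*y)
open import Data.Empty using (⊥-elim)
open import Data.Product using (_×_; _,_; proj₁; proj₂; ∃-syntax; ∃₂)
open import Data.Sum using (inj₁; inj₂; [_,_]′; _⊎_)
open import Data.List using ([]; _∷_; _++_; map; concatMap; filter; upTo; applyUpTo)
open import Data.List.Properties using (map-applyUpTo; length-map; length-++; length-upTo; length-filter; filter-++; filter-accept; filter-reject; filter-none)
open import Data.List.Relation.Unary.All as All using ([]; _∷_)
open import Data.List.Relation.Unary.All.Properties as All using ()
open import Data.List.Relation.Unary.Any as Any using (Any; here; there)
open import Data.List.Relation.Unary.Any.Properties as Any using ()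
open import Data.List.Relation.Unary.AllPairs using ([]; _∷_)
open import Data.List.Relation.Unary.Linked as Linked using (Linked; []; [-]; _∷_)
open import Data.List.Relation.Unary.Linked.Properties as Linked using ()
open import Data.List.Relation.Unary.Unique.Propositional.Properties as Unique using ()
open import Data.List.Relation.Binary.Disjoint.Propositional using (Disjoint)
open import Data.List.Membership.Propositional using (_∈_; find)
open import Data.List.Membership.Propositional.Properties using (∈-map⁺; ∈-map⁻; ∈-upTo⁺; ∈-upTo⁻; ∈-filter⁺; ∈-filter⁻; ∈-concat⁺; ∈-concat⁻; ∈-∃++; ∈-++⁻; ∈-++⁺ˡ; ∈-++⁺ʳ)
open import Function using (_∘_; const; id)
open import Induction.WellFounded using (Acc; acc)
open import Relation.Binary.PropositionalEquality
open import Relation.Nullary using (Dec; yes; no; ¬_)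
open import Relation.Nullary.Decidable using (_×-dec_)
open import Relation.Unary using (Decidable)

-- Arithmetic and finite sums

infix 8 _²
_² : ℕ → ℕ
n ² = n * n

²-mono-≤ : ∀ {m n} → m ≤ n → m ² ≤ n ²
²-mono-≤ m≤n = *-mono-≤ m≤n m≤n

m≡0⇒m≤n : ∀ {m n} → m ≡ 0 → m ≤ n
m≡0⇒m≤n refl = z≤n

∣m-n∣²+2mn≡m²+n² : ∀ m n → ∣ m - n ∣ ² + 2 * (m * n) ≡ m ² + n ²
∣m-n∣²+2mn≡m²+n² zero    n       = +-identityʳ (n ²)
∣m-n∣²+2mn≡m²+n² (suc m) zero    = cong (suc m ² +_) (cong (2 *_) (*-zeroʳ (suc m)))
∣m-n∣²+2mn≡m²+n² (suc m) (suc n) = begin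
  ∣ m - n ∣ ² + 2 * (suc m * suc n)                ≡⟨ expand (∣ m - n ∣ ²) m n ⟩
  ∣ m - n ∣ ² + 2 * (m * n) + 2 * m + 2 * n + 2    ≡⟨ cong (λ x → x + 2 * m + 2 * n + 2) (∣m-n∣²+2mn≡m²+n² m n) ⟩
  m ² + n ² + 2 * m + 2 * n + 2                    ≡⟨ collect m n ⟩
  suc m ² + suc n ²                                ∎
  where
  open ≡-Reasoning
  expand : ∀ d m n → d + 2 * ((1 + m) * (1 + n)) ≡ d + 2 * (m * n) + 2 * m + 2 * n + 2
  expand = solve-∀
  collect : ∀ m n → m * m + n * n + 2 * m + 2 * n + 2 ≡ (1 + m) * (1 + m) + (1 + n) * (1 + n)
  collect = solve-∀

⌊n/2⌋-bounds : ∀ n → ⌊ n /2⌋ + ⌊ n /2⌋ ≤ n × n ≤ suc (⌊ n /2⌋ + ⌊ n /2⌋)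
⌊n/2⌋-bounds 0             = z≤n , z≤n
⌊n/2⌋-bounds 1             = z≤n , s≤s z≤n
⌊n/2⌋-bounds (suc (suc n)) with ⌊n/2⌋-bounds n
... | lower , upper = s≤s (subst (_≤ suc n) (sym (+-suc h h)) (s≤s lower))
                    , s≤s (s≤s (subst (n ≤_) (sym (+-suc h h)) upper))
  where h = ⌊ n /2⌋

∑< : ℕ → (ℕ → ℕ) → ℕ
∑< zero    f = 0
∑< (suc n) f = f 0 + ∑< n (f ∘ suc)

infix 6.5 ∑<
syntax ∑< n (λ k → e) = ∑[ k < n ] e

∑-cong : ∀ n {f g : ℕ → ℕ} → (∀ k → k < n → f k ≡ g k) → ∑< n f ≡ ∑< n g
∑-cong zero    eq = refl
∑-cong (suc n) eq = cong₂ _+_ (eq 0 z<s) (∑-cong n (λ k k<n → eq (suc k) (s<s k<n)))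

∑-mono-≤ : ∀ n {f g : ℕ → ℕ} → (∀ k → k < n → f k ≤ g k) → ∑< n f ≤ ∑< n g
∑-mono-≤ zero    le = z≤n
∑-mono-≤ (suc n) le = +-mono-≤ (le 0 z<s) (∑-mono-≤ n (λ k k<n → le (suc k) (s<s k<n)))

∑-distrib-+ : ∀ n (f g : ℕ → ℕ) → ∑[ k < n ] (f k + g k) ≡ ∑< n f + ∑< n g
∑-distrib-+ zero    f g = refl
∑-distrib-+ (suc n) f g =
  trans (cong (f 0 + g 0 +_) (∑-distrib-+ n (f ∘ suc) (g ∘ suc))) (+-interchange (f 0) (g 0) _ _)

∑-*-identityʳ : ∀ n (f : ℕ → ℕ) → ∑[ k < n ] f k * 1 ≡ ∑< n f
∑-*-identityʳ n f = ∑-cong n (λ k _ → *-identityʳ (f k))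

∑-distribˡ-* : ∀ n c (f : ℕ → ℕ) → ∑[ k < n ] (c * f k) ≡ c * ∑< n f
∑-distribˡ-* zero    c f = sym (*-zeroʳ c)
∑-distribˡ-* (suc n) c f =
  trans (cong (c * f 0 +_) (∑-distribˡ-* n c (f ∘ suc))) (sym (*-distribˡ-+ c (f 0) _))

∑-const : ∀ n c → ∑[ _ < n ] c ≡ n * c
∑-const zero    c = refl
∑-const (suc n) c = cong (c +_) (∑-const n c)

∑-split : ∀ a b (f : ℕ → ℕ) → ∑< (a + b) f ≡ ∑< a f + ∑[ k < b ] f (a + k)
∑-split zero    b f = refl
∑-split (suc a) b f = trans (cong (f 0 +_) (∑-split a b (f ∘ suc))) (sym (+-assoc (f 0) _ _))

∑-vanishing : ∀ n {f : ℕ → ℕ} → (∀ k → k < n → f k ≡ 0) → ∑< n f ≡ 0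
∑-vanishing n {f} f≡0 = trans (∑-cong n f≡0) (trans (∑-const n 0) (*-zeroʳ n))

∑-beyond-support : ∀ {a b} (f : ℕ → ℕ) → (∀ k → a ≤ k → f k ≡ 0) → a ≤ b → ∑< b f ≡ ∑< a f
∑-beyond-support {a} {b} f f≡0 a≤b = begin
  ∑< b f                              ≡⟨ cong (λ c → ∑< c f) (m+[n∸m]≡n a≤b) ⟨
  ∑< (a + (b ∸ a)) f                  ≡⟨ ∑-split a (b ∸ a) f ⟩
  ∑< a f + ∑[ k < b ∸ a ] f (a + k)   ≡⟨ cong (∑< a f +_) (∑-vanishing (b ∸ a) (λ k _ → f≡0 (a + k) (m≤m+n a k))) ⟩
  ∑< a f + 0                          ≡⟨ +-identityʳ _ ⟩
  ∑< a f                              ∎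
  where open ≡-Reasoning

∑-monoˡ-≤ : ∀ {a b} (f : ℕ → ℕ) → a ≤ b → ∑< a f ≤ ∑< b f
∑-monoˡ-≤ {a} {b} f a≤b = begin
  ∑< a f                              ≤⟨ m≤m+n (∑< a f) _ ⟩
  ∑< a f + ∑[ k < b ∸ a ] f (a + k)   ≡⟨ ∑-split a (b ∸ a) f ⟨
  ∑< (a + (b ∸ a)) f                  ≡⟨ cong (λ c → ∑< c f) (m+[n∸m]≡n a≤b) ⟩
  ∑< b f                              ∎
  where open ≤-Reasoning

∑-last : ∀ n (f : ℕ → ℕ) → ∑< (suc n) f ≡ ∑< n f + f n
∑-last zero    f = +-comm (f 0) 0
∑-last (suc n) f = trans (cong (f 0 +_) (∑-last n (f ∘ suc))) (sym (+-assoc (f 0) _ _))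

∑-reverse : ∀ n (f : ℕ → ℕ) → ∑< n f ≡ ∑[ k < n ] f (n ∸ suc k)
∑-reverse zero    f = refl
∑-reverse (suc n) f = begin
  ∑< (suc n) f                        ≡⟨ ∑-last n f ⟩
  ∑< n f + f n                        ≡⟨ +-comm (∑< n f) (f n) ⟩
  f n + ∑< n f                        ≡⟨ cong (f n +_) (∑-reverse n f) ⟩
  f n + ∑[ k < n ] f (n ∸ suc k)      ∎
  where open ≡-Reasoning

term≤∑ : ∀ n (f : ℕ → ℕ) {k} → k < n → f k ≤ ∑< n f
term≤∑ (suc n) f {zero}  _         = m≤m+n (f 0) _
term≤∑ (suc n) f {suc k} (s<s k<n) = ≤-trans (term≤∑ n (f ∘ suc) k<n) (m≤n+m _ (f 0))

∑-blocks : ∀ Q w (g : ℕ → ℕ) → ∑< (Q * w) g ≡ ∑[ r < Q ] ∑[ i < w ] g (r * w + i)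
∑-blocks zero    w g = refl
∑-blocks (suc Q) w g = trans (∑-split w (Q * w) g) (cong (∑< w g +_) (trans (∑-blocks Q w (λ k → g (w + k)))
  (∑-cong Q λ r _ → ∑-cong w λ i _ → cong g (sym (+-assoc w (r * w) i)))))

-- Log-concave sequences and moving sums

shift : (ℕ → ℕ) → ℕ → ℕ
shift f zero    = 0
shift f (suc k) = f k

shiftBy : ℕ → (ℕ → ℕ) → ℕ → ℕ
shiftBy zero    f = f
shiftBy (suc a) f = shift (shiftBy a f)

-- The coefficients of (1 + x + ⋯ + xᵛ) · ∑ f k xᵏ.
movingSum : ℕ → (ℕ → ℕ) → ℕ → ℕ
movingSum zero    f k = f k
movingSum (suc v) f k = f k + shift (movingSum v f) k

shiftBy-below : ∀ a f {k} → k < a → shiftBy a f k ≡ 0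
shiftBy-below (suc a) f {zero}  _         = refl
shiftBy-below (suc a) f {suc k} (s<s k<a) = shiftBy-below a f k<a

shiftBy-+ : ∀ a f k → shiftBy a f (a + k) ≡ f k
shiftBy-+ zero    f k = refl
shiftBy-+ (suc a) f k = shiftBy-+ a f k

movingSum-at-0 : ∀ v f → movingSum v f 0 ≡ f 0
movingSum-at-0 zero    f = refl
movingSum-at-0 (suc v) f = +-identityʳ (f 0)

-- M (i + 1) − M i = f (i + 1) − f (i − v) for M = movingSum v f, moved so that no
-- subtraction occurs.
movingSum-increment : ∀ v f i → movingSum v f (suc i) + shiftBy v f i ≡ f (suc i) + movingSum v f i
movingSum-increment zero    f i = refl
movingSum-increment (suc v) f i =
  trans (+-assoc (f (suc i)) (movingSum v f i) _) (cong (f (suc i) +_) (shifted i))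
  where
  shifted : ∀ i → movingSum v f i + shiftBy (suc v) f i ≡ f i + shift (movingSum v f) i
  shifted zero    = trans (+-identityʳ _) (trans (movingSum-at-0 v f) (sym (+-identityʳ _)))
  shifted (suc i) = movingSum-increment v f i

-- f (c + k) / f k is nonincreasing in k for every gap c; for sequences
-- without internal zeros this is log-concavity.
LogConcave : (ℕ → ℕ) → Set
LogConcave f = ∀ c {p q} → p ≤ q → f p * f (c + q) ≤ f (c + p) * f q

LogConcave₁ : (ℕ → ℕ) → Set
LogConcave₁ f = ∀ {p q} → p ≤ q → f p * f (suc q) ≤ f (suc p) * f q

private
  0<m*n⇒0<m : ∀ m {n} → 0 < m * n → 0 < m
  0<m*n⇒0<m (suc m) _ = z<s

module _ {f : ℕ → ℕ} (lc : LogConcave f) where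

  private
    f-movingSum-ratio : ∀ v c {i j} → i ≤ j → f (c + j) * movingSum v f i ≤ f (c + i) * movingSum v f j
    f-movingSum-ratio zero    c {i} {j} i≤j = subst (_≤ f (c + i) * f j) (*-comm (f i) (f (c + j))) (lc c i≤j)
    f-movingSum-ratio (suc v) c {i} {j} i≤j = begin
      f (c + j) * (f i + shift (movingSum v f) i)                    ≡⟨ *-distribˡ-+ (f (c + j)) (f i) _ ⟩
      f (c + j) * f i + f (c + j) * shift (movingSum v f) i          ≤⟨ +-mono-≤ (f-movingSum-ratio zero c i≤j) (shifted i≤j) ⟩
      f (c + i) * f j + f (c + i) * shift (movingSum v f) j          ≡⟨ *-distribˡ-+ (f (c + i)) (f j) _ ⟨
      f (c + i) * (f j + shift (movingSum v f) j)                    ∎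
      where
      open ≤-Reasoning
      shifted : ∀ {i j} → i ≤ j → f (c + j) * shift (movingSum v f) i ≤ f (c + i) * shift (movingSum v f) j
      shifted {zero}  {j}     _         = m≡0⇒m≤n (*-zeroʳ (f (c + j)))
      shifted {suc i} {suc j} (s≤s i≤j) = subst₂ (λ a b → f a * movingSum v f i ≤ f b * movingSum v f j)
        (sym (+-suc c j)) (sym (+-suc c i)) (f-movingSum-ratio v (suc c) i≤j)

    shiftBy-ratio : ∀ a {i j} → i ≤ j → shiftBy a f i * f j ≤ shiftBy a f j * f i
    shiftBy-ratio a {i} {j} i≤j with i <? a
    ... | yes i<a = m≡0⇒m≤n (cong (_* f j) (shiftBy-below a f i<a))
    ... | no  i≮a = subst₂ (λ x y → shiftBy a f x * f y ≤ shiftBy a f y * f x) i≡ j≡ shifted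
      where
      a≤i = ≮⇒≥ i≮a
      i≡ : a + (i ∸ a) ≡ i
      i≡ = m+[n∸m]≡n a≤i
      j≡ : a + (j ∸ a) ≡ j
      j≡ = m+[n∸m]≡n (≤-trans a≤i i≤j)
      shifted : shiftBy a f (a + (i ∸ a)) * f (a + (j ∸ a)) ≤ shiftBy a f (a + (j ∸ a)) * f (a + (i ∸ a))
      shifted rewrite shiftBy-+ a f (i ∸ a) | shiftBy-+ a f (j ∸ a) =
        subst (f (i ∸ a) * f (a + (j ∸ a)) ≤_) (*-comm (f (a + (i ∸ a))) (f (j ∸ a))) (lc a (∸-monoˡ-≤ a i≤j))

    shiftBy-movingSum-ratio : ∀ v {i j} → i ≤ j → shiftBy v f i * movingSum v f j ≤ shiftBy v f j * movingSum v f i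
    shiftBy-movingSum-ratio zero    {i} {j} _   = ≤-reflexive (*-comm (f i) (f j))
    shiftBy-movingSum-ratio (suc v) {i} {j} i≤j = begin
      X i * (f j + shift (movingSum v f) j)                ≡⟨ *-distribˡ-+ (X i) (f j) _ ⟩
      X i * f j + X i * shift (movingSum v f) j            ≤⟨ +-mono-≤ (shiftBy-ratio (suc v) i≤j) (shifted i≤j) ⟩
      X j * f i + X j * shift (movingSum v f) i            ≡⟨ *-distribˡ-+ (X j) (f i) _ ⟨
      X j * (f i + shift (movingSum v f) i)                ∎
      where
      open ≤-Reasoning
      X = shiftBy (suc v) f
      shifted : ∀ {i j} → i ≤ j → X i * shift (movingSum v f) j ≤ X j * shift (movingSum v f) i
      shifted {zero}  _         = z≤n
      shifted {suc i} (s≤s i≤j) = shiftBy-movingSum-ratio v i≤j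

  -- By movingSum-increment, the claim splits into the two cross inequalities above.
  movingSum-logConcave₁ : ∀ v → LogConcave₁ (movingSum v f)
  movingSum-logConcave₁ v {i} {j} i≤j = +-cancelʳ-≤ (M i * X j) (M i * M (suc j)) (M (suc i) * M j) (begin
    M i * M (suc j) + M i * X j              ≡⟨ *-distribˡ-+ (M i) (M (suc j)) (X j) ⟨
    M i * (M (suc j) + X j)                  ≡⟨ cong (M i *_) (movingSum-increment v f j) ⟩
    M i * (f (suc j) + M j)                  ≡⟨ *-distribˡ-+ (M i) (f (suc j)) (M j) ⟩
    M i * f (suc j) + M i * M j              ≤⟨ +-monoˡ-≤ (M i * M j) fM ⟩
    f (suc i) * M j + M i * M j              ≡⟨ *-distribʳ-+ (M j) (f (suc i)) (M i) ⟨
    (f (suc i) + M i) * M j                  ≡⟨ cong (_* M j) (movingSum-increment v f i) ⟨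
    (M (suc i) + X i) * M j                  ≡⟨ *-distribʳ-+ (M j) (M (suc i)) (X i) ⟩
    M (suc i) * M j + X i * M j              ≤⟨ +-monoʳ-≤ (M (suc i) * M j) (shiftBy-movingSum-ratio v i≤j) ⟩
    M (suc i) * M j + X j * M i              ≡⟨ cong (M (suc i) * M j +_) (*-comm (X j) (M i)) ⟩
    M (suc i) * M j + M i * X j              ∎)
    where
    open ≤-Reasoning
    M = movingSum v f
    X = shiftBy v f
    fM : M i * f (suc j) ≤ f (suc i) * M j
    fM = subst₂ _≤_ (*-comm (f (suc j)) (M i)) (*-comm (M j) (f (suc i)))
           (subst (f (suc j) * M i ≤_) (*-comm (f (suc i)) (M j)) (f-movingSum-ratio v 1 i≤j))

module _ {f : ℕ → ℕ} (lc : LogConcave₁ f) where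

  private
    no-internal-zeros-+ : ∀ d {a b} → 0 < f a → 0 < f b → a + d ≤ b → 0 < f (a + d)
    no-internal-zeros-+ zero    {a}         fa>0 _    _  = subst (λ x → 0 < f x) (sym (+-identityʳ a)) fa>0
    no-internal-zeros-+ (suc d) {a} {zero}  _    _    le = ⊥-elim (1+n≢0 (n≤0⇒n≡0 (subst (_≤ 0) (+-suc a d) le)))
    no-internal-zeros-+ (suc d) {a} {suc b} fa>0 fb>0 le =
      subst (λ x → 0 < f x) (sym (+-suc a d)) (no-internal-zeros-+ d fsa>0 fb>0 sa+d≤sb)
      where
      sa+d≤sb : suc a + d ≤ suc b
      sa+d≤sb = subst (_≤ suc b) (+-suc a d) le
      fsa>0 : 0 < f (suc a)
      fsa>0 = 0<m*n⇒0<m (f (suc a)) (<-≤-trans (*-mono-< fa>0 fb>0) (lc (≤-pred (≤-trans (s≤s (m≤m+n a d)) sa+d≤sb))))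

    no-internal-zeros : ∀ {a b k} → 0 < f a → 0 < f b → a ≤ k → k ≤ b → 0 < f k
    no-internal-zeros {a} fa>0 fb>0 a≤k k≤b = subst (λ x → 0 < f x) (m+[n∸m]≡n a≤k)
      (no-internal-zeros-+ _ fa>0 fb>0 (subst (_≤ _) (sym (m+[n∸m]≡n a≤k)) k≤b))

  -- The gap-(c+1) inequality is the product of the gap-c one and a gap-1 one,
  -- divided by f (c + p) * f (c + q), which is positive by the absence of internal zeros.
  logConcave₁⇒logConcave : LogConcave f
  logConcave₁⇒logConcave zero    {p} {q} _   = ≤-refl
  logConcave₁⇒logConcave (suc c) {p} {q} p≤q with f p ≟ 0 | f (suc c + q) ≟ 0
  ... | yes fp≡0 | _         = m≡0⇒m≤n (cong (_* f (suc c + q)) fp≡0)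
  ... | no  _    | yes fq≡0  = m≡0⇒m≤n (trans (cong (f p *_) fq≡0) (*-zeroʳ (f p)))
  ... | no fp≢0  | no fq≢0   = *-cancelˡ-≤ (A * B) {{>-nonZero (*-mono-< A>0 B>0)}} (begin
    A * B * (f p * f (suc c + q))        ≡⟨ rearrange A B (f p) (f (suc c + q)) ⟩
    (f p * B) * (A * f (suc c + q))      ≤⟨ *-mono-≤ (logConcave₁⇒logConcave c p≤q) (lc (+-monoʳ-≤ c p≤q)) ⟩
    (A * f q) * (f (suc c + p) * B)      ≡⟨ rearrange′ A (f q) (f (suc c + p)) B ⟩
    A * B * (f (suc c + p) * f q)        ∎)
    where
    open ≤-Reasoning
    A = f (c + p)
    B = f (c + q)
    fp>0 = n≢0⇒n>0 fp≢0
    fq>0 = n≢0⇒n>0 fq≢0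
    A>0 : 0 < A
    A>0 = no-internal-zeros fp>0 fq>0 (m≤n+m p c) (≤-trans (+-monoʳ-≤ c p≤q) (n≤1+n (c + q)))
    B>0 : 0 < B
    B>0 = no-internal-zeros fp>0 fq>0 (≤-trans p≤q (m≤n+m q c)) (n≤1+n (c + q))
    rearrange : ∀ a b x y → a * b * (x * y) ≡ (x * b) * (a * y)
    rearrange = solve-∀
    rearrange′ : ∀ a b x y → (a * b) * (x * y) ≡ a * y * (x * b)
    rearrange′ = solve-∀

movingSum-logConcave : ∀ {f} → LogConcave f → ∀ v → LogConcave (movingSum v f)
movingSum-logConcave {f} lc v = logConcave₁⇒logConcave {movingSum v f} (movingSum-logConcave₁ {f} lc v)

-- Rank sizes of a product of chains

δ₀ : ℕ → ℕ
δ₀ zero    = 1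
δ₀ (suc _) = 0

δ₀-logConcave : LogConcave δ₀
δ₀-logConcave c       {suc p}         _ = z≤n
δ₀-logConcave zero    {zero}          _ = ≤-refl
δ₀-logConcave (suc c) {zero}          _ = z≤n

movingSum-support : ∀ {f R} → (∀ k → R < k → f k ≡ 0) → ∀ v k → v + R < k → movingSum v f k ≡ 0
movingSum-support supp zero    k       R<k         = supp k R<k
movingSum-support supp (suc v) (suc k) (s<s v+R<k) =
  cong₂ _+_ (supp (suc k) (m≤n⇒m≤1+n (≤-trans (s≤s (m≤n+m _ v)) v+R<k))) (movingSum-support supp v k v+R<k)

module MovingSumMoments (f : ℕ → ℕ) (R : ℕ) (supp : ∀ k → R < k → f k ≡ 0) where

  F : (ℕ → ℕ) → ℕ
  F g = ∑[ k < suc R ] f k * g k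

  W : ℕ → (ℕ → ℕ) → ℕ
  W v g = ∑[ k < suc (v + R) ] movingSum v f k * g k

  W-suc : ∀ v g → W (suc v) g ≡ F g + W v (g ∘ suc)
  W-suc v g = begin
    ∑[ k < suc (suc v + R) ] (f k + shift (movingSum v f) k) * g k
      ≡⟨ ∑-cong (suc (suc v + R)) (λ k _ → *-distribʳ-+ (g k) (f k) (shift (movingSum v f) k)) ⟩
    ∑[ k < suc (suc v + R) ] (f k * g k + shift (movingSum v f) k * g k)
      ≡⟨ ∑-distrib-+ (suc (suc v + R)) (λ k → f k * g k) (λ k → shift (movingSum v f) k * g k) ⟩
    ∑[ k < suc (suc v + R) ] f k * g k + W v (g ∘ suc)
      ≡⟨ cong (_+ W v (g ∘ suc)) (∑-beyond-support (λ k → f k * g k) f≡0 (s≤s (m≤n+m R (suc v)))) ⟩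
    F g + W v (g ∘ suc) ∎
    where
    open ≡-Reasoning
    f≡0 : ∀ k → suc R ≤ k → f k * g k ≡ 0
    f≡0 k R<k = cong (_* g k) (supp k R<k)

  W-cong : ∀ v {g h} → (∀ k → g k ≡ h k) → W v g ≡ W v h
  W-cong v g≡h = ∑-cong (suc (v + R)) (λ k _ → cong (movingSum v f k *_) (g≡h k))

  W-+ : ∀ v g h → W v (λ k → g k + h k) ≡ W v g + W v h
  W-+ v g h = trans (∑-cong (suc (v + R)) (λ k _ → *-distribˡ-+ (movingSum v f k) (g k) (h k)))
                    (∑-distrib-+ (suc (v + R)) (λ k → movingSum v f k * g k) (λ k → movingSum v f k * h k))

  W-* : ∀ v c g → W v (λ k → c * g k) ≡ c * W v g
  W-* v c g = trans (∑-cong (suc (v + R)) (λ k _ → x*[y*z]≡y*[x*z] (movingSum v f k) c (g k)))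
                    (∑-distribˡ-* (suc (v + R)) c (λ k → movingSum v f k * g k))

  F₀ F₁ F₂ : ℕ
  F₀ = F (const 1)
  F₁ = F id
  F₂ = F _²

  W₀ : ∀ v → W v (const 1) ≡ suc v * F₀
  W₀ zero    = sym (+-identityʳ F₀)
  W₀ (suc v) = trans (W-suc v (const 1)) (cong (F₀ +_) (W₀ v))

  W-suc-id : ∀ v → W v suc ≡ W v id + suc v * F₀
  W-suc-id v = begin
    W v suc                   ≡⟨ W-cong v (λ k → +-comm 1 k) ⟩
    W v (λ k → k + 1)         ≡⟨ W-+ v id (const 1) ⟩
    W v id + W v (const 1)    ≡⟨ cong (W v id +_) (W₀ v) ⟩
    W v id + suc v * F₀       ∎
    where open ≡-Reasoning

  W-suc-² : ∀ v → W v (λ k → suc k ²) ≡ W v _² + 2 * W v id + suc v * F₀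
  W-suc-² v = begin
    W v (λ k → suc k ²)                        ≡⟨ W-cong v expand ⟩
    W v (λ k → k ² + 2 * k + 1)                ≡⟨ W-+ v (λ k → k ² + 2 * k) (const 1) ⟩
    W v (λ k → k ² + 2 * k) + W v (const 1)    ≡⟨ cong₂ _+_ (W-+ v _² (λ k → 2 * k)) (W₀ v) ⟩
    W v _² + W v (λ k → 2 * k) + suc v * F₀    ≡⟨ cong (λ x → W v _² + x + suc v * F₀) (W-* v 2 id) ⟩
    W v _² + 2 * W v id + suc v * F₀           ∎
    where
    open ≡-Reasoning
    expand : ∀ k → suc k * suc k ≡ k * k + 2 * k + 1
    expand = solve-∀

  W₁ : ∀ v → 2 * W v id ≡ 2 * suc v * F₁ + v * suc v * F₀
  W₁ zero    = sym (+-identityʳ _)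
  W₁ (suc v) = begin
    2 * W (suc v) id                                                ≡⟨ cong (2 *_) (W-suc v id) ⟩
    2 * (F₁ + W v suc)                                              ≡⟨ cong (λ x → 2 * (F₁ + x)) (W-suc-id v) ⟩
    2 * (F₁ + (W v id + suc v * F₀))                                ≡⟨ regroup F₁ (W v id) (suc v * F₀) ⟩
    2 * F₁ + 2 * W v id + 2 * (suc v * F₀)                          ≡⟨ cong (λ x → 2 * F₁ + x + 2 * (suc v * F₀)) (W₁ v) ⟩
    2 * F₁ + (2 * suc v * F₁ + v * suc v * F₀) + 2 * (suc v * F₀)   ≡⟨ collect v F₁ F₀ ⟩
    2 * suc (suc v) * F₁ + suc v * suc (suc v) * F₀                 ∎
    where
    open ≡-Reasoning
    regroup : ∀ a b c → 2 * (a + (b + c)) ≡ 2 * a + 2 * b + 2 * c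
    regroup = solve-∀
    collect : ∀ v a b → 2 * a + (2 * (1 + v) * a + v * (1 + v) * b) + 2 * ((1 + v) * b)
                        ≡ 2 * (2 + v) * a + (1 + v) * (2 + v) * b
    collect = solve-∀

  W₂ : ∀ v → 6 * W v _² ≡ 6 * suc v * F₂ + 6 * v * suc v * F₁ + v * suc v * (2 * v + 1) * F₀
  W₂ zero    = sym (trans (+-identityʳ _) (+-identityʳ _))
  W₂ (suc v) = begin
    6 * W (suc v) _²                                            ≡⟨ cong (6 *_) (W-suc v _²) ⟩
    6 * (F₂ + W v (λ k → suc k ²))                              ≡⟨ cong (λ x → 6 * (F₂ + x)) (W-suc-² v) ⟩
    6 * (F₂ + (W v _² + 2 * W v id + suc v * F₀))               ≡⟨ regroup F₂ (W v _²) (W v id) (suc v * F₀) ⟩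
    6 * F₂ + 6 * W v _² + 6 * (2 * W v id) + 6 * (suc v * F₀)   ≡⟨ cong₂ (λ x y → 6 * F₂ + x + 6 * y + 6 * (suc v * F₀)) (W₂ v) (W₁ v) ⟩
    6 * F₂ + (6 * suc v * F₂ + 6 * v * suc v * F₁ + v * suc v * (2 * v + 1) * F₀)
      + 6 * (2 * suc v * F₁ + v * suc v * F₀) + 6 * (suc v * F₀)
                                                                ≡⟨ collect v F₂ F₁ F₀ ⟩
    6 * suc (suc v) * F₂ + 6 * suc v * suc (suc v) * F₁ + suc v * suc (suc v) * (2 * suc v + 1) * F₀ ∎
    where
    open ≡-Reasoning
    regroup : ∀ a b c d → 6 * (a + (b + 2 * c + d)) ≡ 6 * a + 6 * b + 6 * (2 * c) + 6 * d
    regroup = solve-∀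
    collect : ∀ v a b c → 6 * a + (6 * (1 + v) * a + 6 * v * (1 + v) * b + v * (1 + v) * (2 * v + 1) * c)
                            + 6 * (2 * (1 + v) * b + v * (1 + v) * c) + 6 * ((1 + v) * c)
                          ≡ 6 * (2 + v) * a + 6 * (1 + v) * (2 + v) * b + (1 + v) * (2 + v) * (2 * (1 + v) + 1) * c
    collect = solve-∀

-- rankSizes vs k is the number of elements of rank k in the product of the
-- chains 0 < 1 < ⋯ < v, v ∈ vs: the coefficient of xᵏ in ∏ (1 + x + ⋯ + xᵛ).
rankSizes : List ℕ → ℕ → ℕ
rankSizes []       = δ₀
rankSizes (v ∷ vs) = movingSum v (rankSizes vs)

-- Twelve times the variance of the rank: v (v + 2) / 12 is the variance of
-- the uniform distribution on {0, …, v}.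
spread : List ℕ → ℕ
spread vs = sum (map (λ v → v * (v + 2)) vs)

rankSizes-support : ∀ vs k → sum vs < k → rankSizes vs k ≡ 0
rankSizes-support []       (suc k) _   = refl
rankSizes-support (v ∷ vs) k       R<k = movingSum-support (rankSizes-support vs) v k R<k

rankSizes-logConcave : ∀ vs → LogConcave (rankSizes vs)
rankSizes-logConcave []       = δ₀-logConcave
rankSizes-logConcave (v ∷ vs) = movingSum-logConcave (rankSizes-logConcave vs) v

rankSizes-total : ∀ vs → ∑[ k < suc (sum vs) ] rankSizes vs k ≡ product (map suc vs)
rankSizes-total []       = refl
rankSizes-total (v ∷ vs) = begin
  ∑[ k < suc (v + sum vs) ] rankSizes (v ∷ vs) k   ≡⟨ ∑-*-identityʳ (suc (v + sum vs)) (rankSizes (v ∷ vs)) ⟨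
  W v (const 1)                                    ≡⟨ W₀ v ⟩
  suc v * F₀                                       ≡⟨ cong (suc v *_) (∑-*-identityʳ (suc (sum vs)) (rankSizes vs)) ⟩
  suc v * (∑[ k < suc (sum vs) ] rankSizes vs k)   ≡⟨ cong (suc v *_) (rankSizes-total vs) ⟩
  suc v * product (map suc vs)                     ∎
  where
  open ≡-Reasoning
  open MovingSumMoments (rankSizes vs) (sum vs) (rankSizes-support vs)

private
  rankSizes-F₀ : ∀ vs → MovingSumMoments.F₀ (rankSizes vs) (sum vs) (rankSizes-support vs) ≡ product (map suc vs)
  rankSizes-F₀ vs = trans (∑-*-identityʳ (suc (sum vs)) (rankSizes vs)) (rankSizes-total vs)

rankSizes-mean : ∀ vs → 2 * (∑[ k < suc (sum vs) ] rankSizes vs k * k) ≡ sum vs * product (map suc vs)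
rankSizes-mean []       = refl
rankSizes-mean (v ∷ vs) = begin
  2 * W v id                          ≡⟨ W₁ v ⟩
  2 * suc v * F₁ + v * suc v * F₀     ≡⟨ regroup v F₁ (v * suc v * F₀) ⟩
  suc v * (2 * F₁) + v * suc v * F₀   ≡⟨ cong₂ (λ x y → suc v * x + v * suc v * y) (rankSizes-mean vs) (rankSizes-F₀ vs) ⟩
  suc v * (R * T) + v * suc v * T     ≡⟨ collect R T v ⟩
  (v + R) * (suc v * T)               ∎
  where
  open ≡-Reasoning
  open MovingSumMoments (rankSizes vs) (sum vs) (rankSizes-support vs)
  R = sum vs
  T = product (map suc vs)
  regroup : ∀ v a b → 2 * (1 + v) * a + b ≡ (1 + v) * (2 * a) + b
  regroup = solve-∀
  collect : ∀ R T v → (1 + v) * (R * T) + v * (1 + v) * T ≡ (v + R) * ((1 + v) * T)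
  collect = solve-∀

rankSizes-variance : ∀ vs → 12 * (∑[ k < suc (sum vs) ] rankSizes vs k * k ²)
                            ≡ 3 * sum vs ² * product (map suc vs) + product (map suc vs) * spread vs
rankSizes-variance []       = refl
rankSizes-variance (v ∷ vs) = begin
  12 * W v _²                                                                   ≡⟨ *-assoc 2 6 (W v _²) ⟩
  2 * (6 * W v _²)                                                              ≡⟨ cong (2 *_) (W₂ v) ⟩
  2 * (6 * suc v * F₂ + 6 * v * suc v * F₁ + v * suc v * (2 * v + 1) * F₀)      ≡⟨ regroup v F₂ F₁ F₀ ⟩
  suc v * (12 * F₂) + 6 * v * suc v * (2 * F₁) + 2 * v * suc v * (2 * v + 1) * F₀
    ≡⟨ cong₂ (λ x y → suc v * x + 6 * v * suc v * y + 2 * v * suc v * (2 * v + 1) * F₀) (rankSizes-variance vs) (rankSizes-mean vs) ⟩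
  suc v * (3 * R ² * T + T * S) + 6 * v * suc v * (R * T) + 2 * v * suc v * (2 * v + 1) * F₀
    ≡⟨ cong (λ x → suc v * (3 * R ² * T + T * S) + 6 * v * suc v * (R * T) + 2 * v * suc v * (2 * v + 1) * x) (rankSizes-F₀ vs) ⟩
  suc v * (3 * R ² * T + T * S) + 6 * v * suc v * (R * T) + 2 * v * suc v * (2 * v + 1) * T
    ≡⟨ collect v R T S ⟩
  3 * (v + R) ² * (suc v * T) + suc v * T * (v * (v + 2) + S)                   ∎
  where
  open ≡-Reasoning
  open MovingSumMoments (rankSizes vs) (sum vs) (rankSizes-support vs)
  R = sum vs
  T = product (map suc vs)
  S = spread vs
  regroup : ∀ v a b c → 2 * (6 * (1 + v) * a + 6 * v * (1 + v) * b + v * (1 + v) * (2 * v + 1) * c)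
                        ≡ (1 + v) * (12 * a) + 6 * v * (1 + v) * (2 * b) + 2 * v * (1 + v) * (2 * v + 1) * c
  regroup = solve-∀
  collect : ∀ v R T S → (1 + v) * (3 * (R * R) * T + T * S) + 6 * v * (1 + v) * (R * T) + 2 * v * (1 + v) * (2 * v + 1) * T
                        ≡ 3 * ((v + R) * (v + R)) * ((1 + v) * T) + (1 + v) * T * (v * (v + 2) + S)
  collect = solve-∀

-- Anti-concentration of log-concave sequences

least-counterexample : ∀ {P : ℕ → Set} → Decidable P → ∀ {N} → ¬ P N →
                       ∃[ w ] (w ≤ N × ¬ P w × (∀ {j} → j < w → P j))
least-counterexample {P} P? {N} ¬PN = [ (λ all → ⊥-elim (¬PN (all ≤-refl))) , id ]′ (search N)
  where
  search : ∀ n → (∀ {j} → j ≤ n → P j) ⊎ ∃[ w ] (w ≤ n × ¬ P w × (∀ {j} → j < w → P j))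
  search zero with P? 0
  ... | yes P0  = inj₁ λ { z≤n → P0 }
  ... | no  ¬P0 = inj₂ (0 , z≤n , ¬P0 , λ ())
  search (suc n) with search n
  ... | inj₂ (w , w≤n , ¬Pw , below) = inj₂ (w , m≤n⇒m≤1+n w≤n , ¬Pw , below)
  ... | inj₁ all with P? (suc n)
  ...   | no  ¬Psn = inj₂ (suc n , ≤-refl , ¬Psn , all ∘ s≤s⁻¹)
  ...   | yes Psn  = inj₁ λ {j} j≤sn → [ all ∘ s≤s⁻¹ , (λ { refl → Psn }) ]′ (m≤n⇒m<n∨m≡n j≤sn)

-- 2 a² + 4 a + 6 = ∑_{r ≥ 0} (a + r)² / 2ʳ.
halving-weighted-sum : ∀ (b : ℕ → ℕ) → (∀ q → 2 * b (suc q) ≤ b q) →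
                       ∀ Q a → ∑[ r < Q ] (a + r) ² * b r ≤ (2 * a ² + 4 * a + 6) * b 0
halving-weighted-sum b halves zero    a = z≤n
halving-weighted-sum b halves (suc Q) a = begin
  (a + 0) ² * b 0 + ∑[ r < Q ] (a + suc r) ² * b (suc r)
    ≡⟨ cong₂ _+_ (cong (λ x → x ² * b 0) (+-identityʳ a))
                 (∑-cong Q (λ r _ → cong (λ x → x ² * b (suc r)) (+-suc a r))) ⟩
  a ² * b 0 + ∑[ r < Q ] (suc a + r) ² * b (suc r)
    ≤⟨ +-monoʳ-≤ (a ² * b 0) (halving-weighted-sum (b ∘ suc) (halves ∘ suc) Q (suc a)) ⟩
  a ² * b 0 + (2 * suc a ² + 4 * suc a + 6) * b 1
    ≡⟨ cong (a ² * b 0 +_) (halve-coefficient a (b 1)) ⟩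
  a ² * b 0 + (suc a ² + 2 * suc a + 3) * (2 * b 1)
    ≤⟨ +-monoʳ-≤ (a ² * b 0) (*-monoʳ-≤ (suc a ² + 2 * suc a + 3) (halves 0)) ⟩
  a ² * b 0 + (suc a ² + 2 * suc a + 3) * b 0
    ≡⟨ collect a (b 0) ⟩
  (2 * a ² + 4 * a + 6) * b 0 ∎
  where
  open ≤-Reasoning
  halve-coefficient : ∀ a x → (2 * ((1 + a) * (1 + a)) + 4 * (1 + a) + 6) * x ≡ ((1 + a) * (1 + a) + 2 * (1 + a) + 3) * (2 * x)
  halve-coefficient = solve-∀
  collect : ∀ a x → a * a * x + ((1 + a) * (1 + a) + 2 * (1 + a) + 3) * x ≡ (2 * (a * a) + 4 * a + 6) * x
  collect = solve-∀

DecaysFromZero : (ℕ → ℕ) → Set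
DecaysFromZero h = ∀ w j → h 0 * h (w + j) ≤ h w * h j

halving-secondMoment : ∀ (h : ℕ → ℕ) B {w} .{{_ : NonZero w}} → (∀ j → 2 * h (w + j) ≤ h j) →
                       ∑[ j < suc B ] h j * j ² ≤ w ² * (12 * ∑< w h)
halving-secondMoment h B {w} halves = begin
  ∑[ j < suc B ] h j * j ²                                  ≤⟨ ∑-monoˡ-≤ _ (m≤m*n (suc B) w) ⟩
  ∑[ j < suc B * w ] h j * j ²                              ≡⟨ ∑-blocks (suc B) w _ ⟩
  ∑[ r < suc B ] ∑[ i < w ] h (r * w + i) * (r * w + i) ²   ≤⟨ ∑-mono-≤ (suc B) (λ r _ → ∑-mono-≤ w λ i i<w →
                                                                 *-monoʳ-≤ (h (r * w + i)) (²-mono-≤ (<⇒≤ (+-monoʳ-< (r * w) i<w)))) ⟩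
  ∑[ r < suc B ] ∑[ i < w ] h (r * w + i) * (r * w + w) ²   ≡⟨ ∑-cong (suc B) (λ r _ → pull-out r) ⟩
  ∑[ r < suc B ] (r * w + w) ² * b r                        ≡⟨ ∑-cong (suc B) (λ r _ → factor-w r w (b r)) ⟩
  ∑[ r < suc B ] w ² * ((1 + r) ² * b r)                    ≡⟨ ∑-distribˡ-* (suc B) (w ²) (λ r → (1 + r) ² * b r) ⟩
  w ² * (∑[ r < suc B ] (1 + r) ² * b r)                    ≤⟨ *-monoʳ-≤ (w ²) (halving-weighted-sum b b-halves (suc B) 1) ⟩
  w ² * (12 * ∑< w h)                                       ∎
  where
  open ≤-Reasoning
  b : ℕ → ℕ
  b q = ∑[ i < w ] h (q * w + i)
  b-halves : ∀ q → 2 * b (suc q) ≤ b q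
  b-halves q = subst (_≤ b q) (∑-distribˡ-* w 2 (λ i → h (suc q * w + i)))
    (∑-mono-≤ w (λ i _ → subst (λ x → 2 * h x ≤ h (q * w + i)) (sym (+-assoc w (q * w) i)) (halves (q * w + i))))
  pull-out : ∀ r → ∑[ i < w ] h (r * w + i) * (r * w + w) ² ≡ (r * w + w) ² * b r
  pull-out r = trans (∑-cong w (λ i _ → *-comm (h (r * w + i)) ((r * w + w) ²))) (∑-distribˡ-* w ((r * w + w) ²) (λ i → h (r * w + i)))
  factor-w : ∀ r w x → (r * w + w) * (r * w + w) * x ≡ w * w * ((1 + r) * (1 + r) * x)
  factor-w = solve-∀

-- Let w be the first index with h w < h 0 / 2. Then the mass of h is at least
-- w h 0 / 2, while h halves over every gap w, so halving-secondMoment applies.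
decaying-secondMoment : ∀ (h : ℕ → ℕ) B → (∀ j → B < j → h j ≡ 0) → DecaysFromZero h →
  h 0 * h 0 * (∑[ j < suc B ] h j * j ²) ≤ 48 * (∑< (suc B) h * ∑< (suc B) h * ∑< (suc B) h)
decaying-secondMoment h B supp decay with h 0 ≟ 0
... | yes t≡0 rewrite t≡0 = z≤n
... | no  t≢0 with least-counterexample (λ j → h 0 ≤? 2 * h j) {suc B}
                   (λ t≤2h → t≢0 (n≤0⇒n≡0 (subst (h 0 ≤_) (cong (2 *_) (supp (suc B) ≤-refl)) t≤2h)))
... | w , w≤sB , drop , plateau = begin
    t * t * (∑[ j < suc B ] h j * j ²)    ≤⟨ *-monoʳ-≤ (t * t) (halving-secondMoment h B halves-over-w) ⟩
    t * t * (w ² * (12 * b₀))             ≡⟨ regroup t w b₀ ⟩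
    12 * ((w * t) ² * b₀)                 ≤⟨ *-monoʳ-≤ 12 (*-monoˡ-≤ b₀ (²-mono-≤ wt≤2b₀)) ⟩
    12 * ((2 * b₀) ² * b₀)                ≡⟨ regroup′ b₀ ⟩
    48 * (b₀ * b₀ * b₀)                   ≤⟨ *-monoʳ-≤ 48 (*-mono-≤ (²-mono-≤ b₀≤H) b₀≤H) ⟩
    48 * (H * H * H)                      ∎
  where
  open ≤-Reasoning
  t = h 0
  H = ∑< (suc B) h
  b₀ = ∑< w h
  instance
    w≢0 : NonZero w
    w≢0 = ≢-nonZero λ { refl → drop (m≤m+n t (t + 0)) }

  halves-over-w : ∀ j → 2 * h (w + j) ≤ h j
  halves-over-w j = *-cancelˡ-≤ t {{≢-nonZero t≢0}} (begin
    t * (2 * h (w + j))     ≡⟨ x*[y*z]≡y*[x*z] t 2 (h (w + j)) ⟩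
    2 * (t * h (w + j))     ≤⟨ *-monoʳ-≤ 2 (decay w j) ⟩
    2 * (h w * h j)         ≡⟨ *-assoc 2 (h w) (h j) ⟨
    2 * h w * h j           ≤⟨ *-monoˡ-≤ (h j) (<⇒≤ (≰⇒> drop)) ⟩
    t * h j                 ∎)

  wt≤2b₀ : w * t ≤ 2 * b₀
  wt≤2b₀ = subst₂ _≤_ (∑-const w t) (∑-distribˡ-* w 2 h) (∑-mono-≤ w (λ j j<w → plateau j<w))

  b₀≤H : b₀ ≤ H
  b₀≤H = ∑-monoˡ-≤ h w≤sB

  regroup : ∀ t w x → t * t * (w * w * (12 * x)) ≡ 12 * ((w * t) * (w * t) * x)
  regroup = solve-∀
  regroup′ : ∀ x → 12 * ((2 * x) * (2 * x) * x) ≡ 48 * (x * x * x)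
  regroup′ = solve-∀

∣2k-R∣²≤8∣k-⌊R/2⌋∣²+2 : ∀ R k → ∣ 2 * k - R ∣ ² ≤ 8 * ∣ k - ⌊ R /2⌋ ∣ ² + 2
∣2k-R∣²≤8∣k-⌊R/2⌋∣²+2 R k = ≤-trans (²-mono-≤ triangle) (square-bound ∣ k - m ∣)
  where
  m = ⌊ R /2⌋
  ∣2m-R∣≤1 : ∣ 2 * m - R ∣ ≤ 1
  ∣2m-R∣≤1 with ⌊n/2⌋-bounds R
  ... | lower , upper = begin
    ∣ 2 * m - R ∣   ≡⟨ cong (λ x → ∣ m + x - R ∣) (+-identityʳ m) ⟩
    ∣ m + m - R ∣   ≡⟨ m≤n⇒∣m-n∣≡n∸m lower ⟩
    R ∸ (m + m)     ≤⟨ ∸-monoˡ-≤ (m + m) upper ⟩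
    suc (m + m) ∸ (m + m) ≡⟨ m+n∸n≡m 1 (m + m) ⟩
    1               ∎
    where open ≤-Reasoning
  triangle : ∣ 2 * k - R ∣ ≤ 2 * ∣ k - m ∣ + 1
  triangle = ≤-trans (∣-∣-triangle (2 * k) (2 * m) R) (+-mono-≤ (≤-reflexive (sym (*-distribˡ-∣-∣ 2 k m))) ∣2m-R∣≤1)
  square-bound : ∀ d → (2 * d + 1) ² ≤ 8 * d ² + 2
  square-bound zero    = s≤s z≤n
  square-bound (suc d) = subst₂ _≤_ (sym (lhs d)) (sym (rhs d))
    (+-monoʳ-≤ (4 * suc d ² + 1) (≤-trans (*-monoʳ-≤ 4 (m≤m*n (suc d) (suc d))) (m≤m+n _ 1)))
    where
    lhs : ∀ d → (2 * suc d + 1) * (2 * suc d + 1) ≡ 4 * (suc d * suc d) + 1 + 4 * suc d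
    lhs = solve-∀
    rhs : ∀ d → 8 * (suc d * suc d) + 2 ≡ 4 * (suc d * suc d) + 1 + (4 * (suc d * suc d) + 1)
    rhs = solve-∀

*∣2k-R∣²-expansion : ∀ a k R → a * ∣ 2 * k - R ∣ ² + 4 * R * (a * k) ≡ 4 * (a * k ²) + R ² * a
*∣2k-R∣²-expansion a k R = begin
  a * ∣ 2 * k - R ∣ ² + 4 * R * (a * k)   ≡⟨ factor a (∣ 2 * k - R ∣ ²) R k ⟩
  a * (∣ 2 * k - R ∣ ² + 2 * (2 * k * R)) ≡⟨ cong (a *_) (∣m-n∣²+2mn≡m²+n² (2 * k) R) ⟩
  a * ((2 * k) ² + R ²)                   ≡⟨ expand a k R ⟩
  4 * (a * k ²) + R ² * a                 ∎
  where
  open ≡-Reasoning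
  factor : ∀ a d R k → a * d + 4 * R * (a * k) ≡ a * (d + 2 * (2 * k * R))
  factor = solve-∀
  expand : ∀ a k R → a * ((2 * k) * (2 * k) + R * R) ≡ 4 * (a * (k * k)) + R * R * a
  expand = solve-∀

-- The identities are the mean R / 2 and the variance S / 12 of the distribution f / T.
centred-secondMoment : ∀ (f : ℕ → ℕ) R S →
  2 * (∑[ k < suc R ] f k * k) ≡ R * ∑< (suc R) f →
  12 * (∑[ k < suc R ] f k * k ²) ≡ 3 * R ² * ∑< (suc R) f + ∑< (suc R) f * S →
  3 * (∑[ k < suc R ] f k * ∣ 2 * k - R ∣ ²) ≡ ∑< (suc R) f * S
centred-secondMoment f R S mean variance = +-cancelʳ-≡ (6 * (R ² * T)) (3 * D) (T * S) (begin
  3 * D + 6 * (R ² * T)               ≡⟨ cong (3 * D +_) (reassoc R T) ⟩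
  3 * D + 6 * R * (R * T)             ≡⟨ cong (λ x → 3 * D + 6 * R * x) mean ⟨
  3 * D + 6 * R * (2 * M₁)            ≡⟨ regroup D R M₁ ⟩
  3 * (D + 4 * R * M₁)                ≡⟨ cong (3 *_) expand-D ⟩
  3 * (4 * M₂ + R ² * T)              ≡⟨ regroup′ M₂ R T ⟩
  12 * M₂ + 3 * (R ² * T)             ≡⟨ cong (_+ 3 * (R ² * T)) variance ⟩
  3 * R ² * T + T * S + 3 * (R ² * T) ≡⟨ collect R T S ⟩
  T * S + 6 * (R ² * T)               ∎)
  where
  open ≡-Reasoning
  T  = ∑< (suc R) f
  M₁ = ∑[ k < suc R ] f k * k
  M₂ = ∑[ k < suc R ] f k * k ²
  D  = ∑[ k < suc R ] f k * ∣ 2 * k - R ∣ ²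

  expand-D : D + 4 * R * M₁ ≡ 4 * M₂ + R ² * T
  expand-D = begin
    D + 4 * R * M₁
      ≡⟨ cong (D +_) (∑-distribˡ-* (suc R) (4 * R) (λ k → f k * k)) ⟨
    D + ∑[ k < suc R ] 4 * R * (f k * k)
      ≡⟨ ∑-distrib-+ (suc R) (λ k → f k * ∣ 2 * k - R ∣ ²) (λ k → 4 * R * (f k * k)) ⟨
    ∑[ k < suc R ] (f k * ∣ 2 * k - R ∣ ² + 4 * R * (f k * k))
      ≡⟨ ∑-cong (suc R) (λ k _ → *∣2k-R∣²-expansion (f k) k R) ⟩
    ∑[ k < suc R ] (4 * (f k * k ²) + R ² * f k)
      ≡⟨ ∑-distrib-+ (suc R) (λ k → 4 * (f k * k ²)) (λ k → R ² * f k) ⟩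
    ∑[ k < suc R ] 4 * (f k * k ²) + ∑[ k < suc R ] R ² * f k
      ≡⟨ cong₂ _+_ (∑-distribˡ-* (suc R) 4 (λ k → f k * k ²)) (∑-distribˡ-* (suc R) (R ²) f) ⟩
    4 * M₂ + R ² * T ∎

  reassoc : ∀ R T → 6 * (R * R * T) ≡ 6 * R * (R * T)
  reassoc = solve-∀
  regroup : ∀ D R M → 3 * D + 6 * R * (2 * M) ≡ 3 * (D + 4 * R * M)
  regroup = solve-∀
  regroup′ : ∀ M R T → 3 * (4 * M + R * R * T) ≡ 12 * M + 3 * (R * R * T)
  regroup′ = solve-∀
  collect : ∀ R T S → 3 * (R * R) * T + T * S + 3 * (R * R * T) ≡ T * S + 6 * (R * R * T)
  collect = solve-∀

reflect : ℕ → (ℕ → ℕ) → ℕ → ℕ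
reflect m f j with j ≤? m
... | yes _ = f (m ∸ j)
... | no  _ = 0

module _ {m : ℕ} {f : ℕ → ℕ} where

  reflect-≤ : ∀ {j} → j ≤ m → reflect m f j ≡ f (m ∸ j)
  reflect-≤ {j} j≤m with j ≤? m
  ... | yes _   = refl
  ... | no  j≰m = ⊥-elim (j≰m j≤m)

  reflect-> : ∀ {j} → m < j → reflect m f j ≡ 0
  reflect-> {j} m<j with j ≤? m
  ... | yes j≤m = ⊥-elim (<⇒≱ m<j j≤m)
  ... | no  _   = refl

∑-reflect : ∀ m f → ∑< (suc m) (reflect m f) ≡ ∑< (suc m) f
∑-reflect m f = begin
  reflect m f 0 + ∑[ j < m ] reflect m f (suc j)   ≡⟨ cong₂ _+_ (reflect-≤ {m} {f} z≤n) (∑-cong m λ j j<m → reflect-≤ {m} {f} j<m) ⟩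
  f m + ∑[ j < m ] f (m ∸ suc j)                   ≡⟨ cong (f m +_) (∑-reverse m f) ⟨
  f m + ∑< m f                                     ≡⟨ +-comm (f m) (∑< m f) ⟩
  ∑< m f + f m                                     ≡⟨ ∑-last m f ⟨
  ∑< (suc m) f                                     ∎
  where open ≡-Reasoning

reflect-decays : ∀ {f} → LogConcave f → ∀ m → DecaysFromZero (reflect m f)
reflect-decays {f} lc m w j = by-cases (w + j ≤? m)
  where
  h = reflect m f
  inside = reflect-≤ {m} {f}
  outside = reflect-> {m} {f}
  by-cases : Dec (w + j ≤ m) → h 0 * h (w + j) ≤ h w * h j
  by-cases (no w+j≰m) = m≡0⇒m≤n (trans (cong (h 0 *_) (outside (≰⇒> w+j≰m))) (*-zeroʳ (h 0)))
  by-cases (yes w+j≤m) = begin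
    h 0 * h (w + j)                     ≡⟨ cong₂ _*_ (inside z≤n) (inside w+j≤m) ⟩
    f m * f (m ∸ (w + j))               ≡⟨ *-comm (f m) _ ⟩
    f (m ∸ (w + j)) * f m               ≡⟨ cong (λ x → f (m ∸ (w + j)) * f x) w+[m∸w]≡m ⟨
    f (m ∸ (w + j)) * f (w + (m ∸ w))   ≤⟨ lc w (∸-monoʳ-≤ m (m≤m+n w j)) ⟩
    f (w + (m ∸ (w + j))) * f (m ∸ w)   ≡⟨ cong (λ x → f x * f (m ∸ w)) w+[m∸[w+j]]≡m∸j ⟩
    f (m ∸ j) * f (m ∸ w)               ≡⟨ *-comm (f (m ∸ j)) (f (m ∸ w)) ⟩
    f (m ∸ w) * f (m ∸ j)               ≡⟨ cong₂ _*_ (inside w≤m) (inside j≤m) ⟨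
    h w * h j                           ∎
    where
    open ≤-Reasoning
    w≤m = ≤-trans (m≤m+n w j) w+j≤m
    j≤m = ≤-trans (m≤n+m j w) w+j≤m
    w+[m∸w]≡m : w + (m ∸ w) ≡ m
    w+[m∸w]≡m = m+[n∸m]≡n w≤m
    w+[m∸[w+j]]≡m∸j : w + (m ∸ (w + j)) ≡ m ∸ j
    w+[m∸[w+j]]≡m∸j = begin-equality
      w + (m ∸ (w + j))      ≡⟨ cong (w +_) (∸-+-assoc m w j) ⟨
      w + (m ∸ w ∸ j)        ≡⟨ +-∸-assoc w (m+n≤o⇒m≤o∸n j (subst (_≤ m) (+-comm w j) w+j≤m)) ⟨
      w + (m ∸ w) ∸ j        ≡⟨ cong (_∸ j) w+[m∸w]≡m ⟩
      m ∸ j                  ∎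

module _ {f : ℕ → ℕ} (lc : LogConcave f) {m : ℕ} where

  right-tail : ∀ {R} → (∀ k → R < k → f k ≡ 0) → m ≤ R →
    f m * f m * (∑[ j < suc (R ∸ m) ] f (m + j) * j ²) ≤ 48 * (∑< (suc R) f * ∑< (suc R) f * ∑< (suc R) f)
  right-tail {R} supp m≤R = begin
    f m * f m * (∑[ j < suc (R ∸ m) ] f (m + j) * j ²)
      ≡⟨ cong (λ x → f x * f x * (∑[ j < suc (R ∸ m) ] f (m + j) * j ²)) (+-identityʳ m) ⟨
    h 0 * h 0 * (∑[ j < suc (R ∸ m) ] h j * j ²)        ≤⟨ decaying-secondMoment h (R ∸ m) h-supp h-decays ⟩
    48 * (H * H * H)                                    ≤⟨ *-monoʳ-≤ 48 (*-mono-≤ (²-mono-≤ H≤T) H≤T) ⟩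
    48 * (T * T * T)                                    ∎
    where
    open ≤-Reasoning
    h = λ j → f (m + j)
    H = ∑< (suc (R ∸ m)) h
    T = ∑< (suc R) f
    suc-R≡ : m + suc (R ∸ m) ≡ suc R
    suc-R≡ = trans (+-suc m (R ∸ m)) (cong suc (m+[n∸m]≡n m≤R))
    h-supp : ∀ j → R ∸ m < j → h j ≡ 0
    h-supp j R∸m<j = supp (m + j) (subst (_< m + j) (m+[n∸m]≡n m≤R) (+-monoʳ-< m R∸m<j))
    h-decays : DecaysFromZero h
    h-decays w j = subst₂ (λ x y → f x * f y ≤ f (m + w) * f (m + j))
      (sym (+-identityʳ m)) (x+[y+z]≡y+[x+z] w m j)
      (subst (λ x → f m * f (w + (m + j)) ≤ f x * f (m + j)) (+-comm w m) (lc w (m≤m+n m j)))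
    H≤T : H ≤ T
    H≤T = begin
      H                         ≤⟨ m≤n+m H (∑< m f) ⟩
      ∑< m f + H                ≡⟨ ∑-split m (suc (R ∸ m)) f ⟨
      ∑< (m + suc (R ∸ m)) f    ≡⟨ cong (λ x → ∑< x f) suc-R≡ ⟩
      T                         ∎

  left-tail : f m * f m * (∑[ j < m ] f (m ∸ suc j) * suc j ²) ≤ 48 * (∑< (suc m) f * ∑< (suc m) f * ∑< (suc m) f)
  left-tail = begin
    f m * f m * (∑[ j < m ] f (m ∸ suc j) * suc j ²)
      ≡⟨ cong (f m * f m *_) (cong₂ _+_ (*-zeroʳ (h 0)) (∑-cong m λ j j<m → cong (_* suc j ²) (reflect-≤ {m} {f} j<m))) ⟨
    h 0 * h 0 * (∑[ j < suc m ] h j * j ²)            ≤⟨ decaying-secondMoment h m (λ j → reflect-> {m} {f}) (reflect-decays lc m) ⟩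
    48 * (H * H * H)                                  ≡⟨ cong (λ x → 48 * (x * x * x)) (∑-reflect m f) ⟩
    48 * (T * T * T)                                  ∎
    where
    open ≤-Reasoning
    h = reflect m f
    H = ∑< (suc m) h
    T = ∑< (suc m) f

  spread-about : ∀ {R} → (∀ k → R < k → f k ≡ 0) → m ≤ R →
    f m * f m * (∑[ k < suc R ] f k * ∣ k - m ∣ ²) ≤ 96 * (∑< (suc R) f * ∑< (suc R) f * ∑< (suc R) f)
  spread-about {R} supp m≤R = begin
    f m * f m * (∑[ k < suc R ] f k * ∣ k - m ∣ ²)     ≡⟨ cong (f m * f m *_) split ⟩
    f m * f m * (L + U)                                ≡⟨ *-distribˡ-+ (f m * f m) L U ⟩
    f m * f m * L + f m * f m * U                      ≤⟨ +-mono-≤ left-bound (right-tail supp m≤R) ⟩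
    48 * T³ + 48 * T³                                  ≡⟨ *-distribʳ-+ T³ 48 48 ⟨
    96 * T³                                            ∎
    where
    open ≤-Reasoning
    T = ∑< (suc R) f
    T³ = T * T * T
    L = ∑[ j < m ] f (m ∸ suc j) * suc j ²
    U = ∑[ j < suc (R ∸ m) ] f (m + j) * j ²
    left-bound : f m * f m * L ≤ 48 * T³
    left-bound = ≤-trans left-tail (*-monoʳ-≤ 48 (*-mono-≤ (²-mono-≤ T′≤T) T′≤T))
      where
      T′≤T : ∑< (suc m) f ≤ T
      T′≤T = ∑-monoˡ-≤ f (s≤s m≤R)
    split : ∑[ k < suc R ] f k * ∣ k - m ∣ ² ≡ L + U
    split = begin-equality
      ∑[ k < suc R ] f k * ∣ k - m ∣ ²
        ≡⟨ cong (λ x → ∑[ k < x ] f k * ∣ k - m ∣ ²) (trans (+-suc m (R ∸ m)) (cong suc (m+[n∸m]≡n m≤R))) ⟨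
      ∑[ k < m + suc (R ∸ m) ] f k * ∣ k - m ∣ ²
        ≡⟨ ∑-split m (suc (R ∸ m)) (λ k → f k * ∣ k - m ∣ ²) ⟩
      ∑[ k < m ] f k * ∣ k - m ∣ ² + ∑[ j < suc (R ∸ m) ] f (m + j) * ∣ m + j - m ∣ ²
        ≡⟨ cong₂ _+_ (∑-reverse m (λ k → f k * ∣ k - m ∣ ²)) (∑-cong (suc (R ∸ m)) λ j _ → cong (λ x → f (m + j) * x ²) (∣m+n-m∣≡n m j)) ⟩
      ∑[ j < m ] f (m ∸ suc j) * ∣ m ∸ suc j - m ∣ ² + U
        ≡⟨ cong (_+ U) (∑-cong m λ j j<m → cong (λ x → f (m ∸ suc j) * x ²) (∣m∸n-m∣≡n j<m)) ⟩
      L + U ∎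
      where
      ∣m+n-m∣≡n : ∀ m n → ∣ m + n - m ∣ ≡ n
      ∣m+n-m∣≡n m n = trans (∣-∣-comm (m + n) m) (∣m-m+n∣≡n m n)
      ∣m∸n-m∣≡n : ∀ {m n} → n ≤ m → ∣ m ∸ n - m ∣ ≡ n
      ∣m∸n-m∣≡n {m} {n} n≤m = trans (cong (λ x → ∣ m ∸ n - x ∣) (sym (m∸n+n≡m n≤m))) (∣m-m+n∣≡n (m ∸ n) n)

-- T S / 3 = ∑ f k (2k − R)² ≤ 8 ∑ f k (k − ⌊R/2⌋)² + 2 T, and by log-concavity the
-- spread about ⌊R/2⌋ is O(T³ / f ⌊R/2⌋²).
logConcave-centre-bound : ∀ {f R} S → (∀ k → R < k → f k ≡ 0) → LogConcave f →
  2 * (∑[ k < suc R ] f k * k) ≡ R * ∑< (suc R) f →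
  12 * (∑[ k < suc R ] f k * k ²) ≡ 3 * R ² * ∑< (suc R) f + ∑< (suc R) f * S →
  f ⌊ R /2⌋ ² * S ≤ 2310 * ∑< (suc R) f ²
logConcave-centre-bound {f} {R} S supp lc mean variance with ∑< (suc R) f ≟ 0
... | yes T≡0 = subst (λ x → x ² * S ≤ 2310 * ∑< (suc R) f ²) (sym (n≤0⇒n≡0 (subst (t ≤_) T≡0 t≤T))) z≤n
  where
  t = f ⌊ R /2⌋
  t≤T = term≤∑ (suc R) f (s≤s (⌊n/2⌋≤n R))
... | no  T≢0 = *-cancelˡ-≤ T {{≢-nonZero T≢0}} (begin
  T * (t ² * S)                          ≡⟨ regroup T t S ⟩
  t ² * (T * S)                          ≡⟨ cong (t ² *_) (centred-secondMoment f R S mean variance) ⟨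
  t ² * (3 * D)                          ≤⟨ *-monoʳ-≤ (t ²) (*-monoʳ-≤ 3 D≤) ⟩
  t ² * (3 * (8 * E + 2 * T))            ≡⟨ expand t E T ⟩
  24 * (t ² * E) + 6 * (t ² * T)         ≤⟨ +-mono-≤ (*-monoʳ-≤ 24 (spread-about lc supp (⌊n/2⌋≤n R))) (*-monoʳ-≤ 6 (*-monoˡ-≤ T (²-mono-≤ t≤T))) ⟩
  24 * (96 * (T * T * T)) + 6 * (T ² * T) ≡⟨ collect T ⟩
  T * (2310 * T ²)                       ∎)
  where
  open ≤-Reasoning
  m = ⌊ R /2⌋
  t = f m
  T = ∑< (suc R) f
  D = ∑[ k < suc R ] f k * ∣ 2 * k - R ∣ ²
  E = ∑[ k < suc R ] f k * ∣ k - m ∣ ²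
  t≤T : t ≤ T
  t≤T = term≤∑ (suc R) f (s≤s (⌊n/2⌋≤n R))
  D≤ : D ≤ 8 * E + 2 * T
  D≤ = begin
    D                                                      ≤⟨ ∑-mono-≤ (suc R) (λ k _ → *-monoʳ-≤ (f k) (∣2k-R∣²≤8∣k-⌊R/2⌋∣²+2 R k)) ⟩
    ∑[ k < suc R ] f k * (8 * ∣ k - m ∣ ² + 2)             ≡⟨ ∑-cong (suc R) (λ k _ → distribute (f k) (∣ k - m ∣ ²)) ⟩
    ∑[ k < suc R ] (8 * (f k * ∣ k - m ∣ ²) + 2 * f k)     ≡⟨ ∑-distrib-+ (suc R) (λ k → 8 * (f k * ∣ k - m ∣ ²)) (λ k → 2 * f k) ⟩
    ∑[ k < suc R ] 8 * (f k * ∣ k - m ∣ ²) + ∑[ k < suc R ] 2 * f k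
                                                           ≡⟨ cong₂ _+_ (∑-distribˡ-* (suc R) 8 (λ k → f k * ∣ k - m ∣ ²)) (∑-distribˡ-* (suc R) 2 f) ⟩
    8 * E + 2 * T                                          ∎
    where
    distribute : ∀ a d → a * (8 * d + 2) ≡ 8 * (a * d) + 2 * a
    distribute = solve-∀
  regroup : ∀ T t S → T * (t * t * S) ≡ t * t * (T * S)
  regroup = solve-∀
  expand : ∀ t E T → t * t * (3 * (8 * E + 2 * T)) ≡ 24 * (t * t * E) + 6 * (t * t * T)
  expand = solve-∀
  collect : ∀ T → 24 * (96 * (T * T * T)) + 6 * (T * T * T) ≡ T * (2310 * (T * T))
  collect = solve-∀

rankSizes-centre-bound : ∀ vs → rankSizes vs ⌊ sum vs /2⌋ ² * spread vs ≤ 2310 * product (map suc vs) ²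
rankSizes-centre-bound vs = subst (λ T → rankSizes vs ⌊ sum vs /2⌋ ² * spread vs ≤ 2310 * T ²) (rankSizes-total vs)
  (logConcave-centre-bound (spread vs) (rankSizes-support vs) (rankSizes-logConcave vs)
    (trans (rankSizes-mean vs) (cong (sum vs *_) (sym (rankSizes-total vs))))
    (trans (rankSizes-variance vs) (cong₂ (λ a b → 3 * sum vs ² * a + b * spread vs) (sym (rankSizes-total vs)) (sym (rankSizes-total vs)))))

-- Symmetric chains

infixl 6 _⊕_
_⊕_ : (ℕ → ℕ) → (ℕ → ℕ) → ℕ → ℕ
(f ⊕ g) k = f k + g k

shift-cong : ∀ {f g : ℕ → ℕ} → f ≗ g → shift f ≗ shift g
shift-cong f≗g zero    = refl
shift-cong f≗g (suc k) = f≗g k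

shiftBy-cong : ∀ {f g : ℕ → ℕ} a → f ≗ g → shiftBy a f ≗ shiftBy a g
shiftBy-cong zero    f≗g = f≗g
shiftBy-cong (suc a) f≗g = shift-cong (shiftBy-cong a f≗g)

movingSum-cong : ∀ {f g : ℕ → ℕ} v → f ≗ g → movingSum v f ≗ movingSum v g
movingSum-cong zero    f≗g k = f≗g k
movingSum-cong (suc v) f≗g k = cong₂ _+_ (f≗g k) (shift-cong (movingSum-cong v f≗g) k)

shift-⊕ : ∀ {f g : ℕ → ℕ} → shift (f ⊕ g) ≗ shift f ⊕ shift g
shift-⊕ zero    = refl
shift-⊕ (suc k) = refl

shiftBy-⊕ : ∀ {f g : ℕ → ℕ} a → shiftBy a (f ⊕ g) ≗ shiftBy a f ⊕ shiftBy a g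
shiftBy-⊕ zero    k = refl
shiftBy-⊕ {f} {g} (suc a) k = trans (shift-cong (shiftBy-⊕ a) k) (shift-⊕ {shiftBy a f} {shiftBy a g} k)

movingSum-⊕ : ∀ {f g : ℕ → ℕ} v → movingSum v (f ⊕ g) ≗ movingSum v f ⊕ movingSum v g
movingSum-⊕ zero    k = refl
movingSum-⊕ {f} {g} (suc v) k =
  trans (cong (f k + g k +_) (trans (shift-cong (movingSum-⊕ v) k) (shift-⊕ {movingSum v f} {movingSum v g} k)))
        (+-interchange (f k) (g k) _ _)

shiftBy-const0 : ∀ a → shiftBy a (const 0) ≗ const 0
shiftBy-const0 zero    k       = refl
shiftBy-const0 (suc a) zero    = refl
shiftBy-const0 (suc a) (suc k) = shiftBy-const0 a k

movingSum-const0 : ∀ v → movingSum v (const 0) ≗ const 0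
movingSum-const0 zero    k       = refl
movingSum-const0 (suc v) zero    = refl
movingSum-const0 (suc v) (suc k) = movingSum-const0 v k

shiftBy-shift : ∀ a g → shiftBy a (shift g) ≗ shiftBy (suc a) g
shiftBy-shift zero    g k = refl
shiftBy-shift (suc a) g k = shift-cong (shiftBy-shift a g) k

movingSum-shift : ∀ v g → movingSum v (shift g) ≗ shift (movingSum v g)
movingSum-shift zero    g k       = refl
movingSum-shift (suc v) g zero    = refl
movingSum-shift (suc v) g (suc k) = cong (g k +_) (movingSum-shift v g k)

movingSum-shiftBy : ∀ v a g → movingSum v (shiftBy a g) ≗ shiftBy a (movingSum v g)
movingSum-shiftBy v zero    g k = refl
movingSum-shiftBy v (suc a) g k = trans (movingSum-shift v (shiftBy a g) k) (shift-cong (movingSum-shiftBy v a g) k)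

ones : ℕ → ℕ → ℕ
ones zero    k       = 0
ones (suc ℓ) zero    = 1
ones (suc ℓ) (suc k) = ones ℓ k

ones-below : ∀ ℓ {k} → k < ℓ → ones ℓ k ≡ 1
ones-below (suc ℓ) {zero}  _         = refl
ones-below (suc ℓ) {suc k} (s<s k<ℓ) = ones-below ℓ k<ℓ

-- The rank profile of the (ℓ + 1) × (v + 2) grid is that of its outer hook
-- plus that of the remaining ℓ × (v + 1) grid, shifted up by one.
mutual
  movingSum-ones : ∀ v ℓ → movingSum (suc v) (ones (suc ℓ)) ≗ ones (suc (suc v + ℓ)) ⊕ shift (movingSum v (ones ℓ))
  movingSum-ones v ℓ zero    = refl
  movingSum-ones v ℓ (suc k) = movingSum-ones′ v ℓ k

  movingSum-ones′ : ∀ v ℓ k → ones ℓ k + movingSum v (ones (suc ℓ)) k ≡ ones (suc v + ℓ) k + movingSum v (ones ℓ) k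
  movingSum-ones′ zero    ℓ k = +-comm (ones ℓ k) (ones (suc ℓ) k)
  movingSum-ones′ (suc v) ℓ k =
    trans (cong (ones ℓ k +_) (movingSum-ones v ℓ k)) (x+[y+z]≡y+[x+z] (ones ℓ k) (ones (suc (suc v + ℓ)) k) _)

record Chain : Set where
  constructor chain
  field
    start    : ℕ
    elements : List ℕ
open Chain

chainProfile : Chain → ℕ → ℕ
chainProfile (chain lo c) = shiftBy lo (ones (length c))

profile : List Chain → ℕ → ℕ
profile []         = const 0
profile (ch ∷ chs) = chainProfile ch ⊕ profile chs

profile-++ : ∀ xs ys → profile (xs ++ ys) ≗ profile xs ⊕ profile ys
profile-++ []       ys k = refl
profile-++ (x ∷ xs) ys k = trans (cong (chainProfile x k +_) (profile-++ xs ys k)) (sym (+-assoc (chainProfile x k) _ _))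

-- hook p v y ys = y, y p, …, y pᵛ followed by the elements of ys times pᵛ.
hook : ℕ → ℕ → ℕ → List ℕ → List ℕ
hook p zero    y ys = y ∷ ys
hook p (suc v) y ys = y ∷ hook p v (y * p) (map (_* p) ys)

-- The product of a chain c with 1 < p < ⋯ < pᵛ, decomposed into nested hooks.
hooks : ℕ → ℕ → Chain → List Chain
hooks p v       (chain lo [])       = []
hooks p zero    (chain lo (y ∷ ys)) = chain lo (y ∷ ys) ∷ []
hooks p (suc v) (chain lo (y ∷ ys)) = chain lo (hook p (suc v) y ys) ∷ hooks p v (chain (suc lo) ys)

extend : ℕ → ℕ → List Chain → List Chain
extend p v = concatMap (hooks p v)

length-hook : ∀ p v y ys → length (hook p v y ys) ≡ suc (v + length ys)
length-hook p zero    y ys = refl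
length-hook p (suc v) y ys =
  cong suc (trans (length-hook p v (y * p) (map (_* p) ys)) (cong (λ ℓ → suc (v + ℓ)) (length-map (_* p) ys)))

profile-hooks : ∀ p v lo c → profile (hooks p v (chain lo c)) ≗ shiftBy lo (movingSum v (ones (length c)))
profile-hooks p v       lo []       k = sym (trans (shiftBy-cong lo (movingSum-const0 v) k) (shiftBy-const0 lo k))
profile-hooks p zero    lo (y ∷ ys) k = +-identityʳ _
profile-hooks p (suc v) lo (y ∷ ys) k = begin
  shiftBy lo (ones (length (hook p (suc v) y ys))) k + profile (hooks p v (chain (suc lo) ys)) k
    ≡⟨ cong₂ _+_ (cong (λ ℓ → shiftBy lo (ones ℓ) k) (length-hook p (suc v) y ys)) (profile-hooks p v (suc lo) ys k) ⟩
  shiftBy lo (ones (suc (suc v + ℓ))) k + shiftBy (suc lo) (movingSum v (ones ℓ)) k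
    ≡⟨ cong (shiftBy lo (ones (suc (suc v + ℓ))) k +_) (shiftBy-shift lo (movingSum v (ones ℓ)) k) ⟨
  shiftBy lo (ones (suc (suc v + ℓ))) k + shiftBy lo (shift (movingSum v (ones ℓ))) k
    ≡⟨ shiftBy-⊕ lo k ⟨
  shiftBy lo (ones (suc (suc v + ℓ)) ⊕ shift (movingSum v (ones ℓ))) k
    ≡⟨ shiftBy-cong lo (movingSum-ones v ℓ) k ⟨
  shiftBy lo (movingSum (suc v) (ones (suc ℓ))) k ∎
  where
  open ≡-Reasoning
  ℓ = length ys

profile-extend : ∀ p v chs → profile (extend p v chs) ≗ movingSum v (profile chs)
profile-extend p v []                  k = sym (movingSum-const0 v k)
profile-extend p v (chain lo c ∷ chs) k = begin
  profile (hooks p v (chain lo c) ++ extend p v chs) k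
    ≡⟨ profile-++ (hooks p v (chain lo c)) (extend p v chs) k ⟩
  profile (hooks p v (chain lo c)) k + profile (extend p v chs) k
    ≡⟨ cong₂ _+_ (profile-hooks p v lo c k) (profile-extend p v chs k) ⟩
  shiftBy lo (movingSum v (ones (length c))) k + movingSum v (profile chs) k
    ≡⟨ cong (_+ movingSum v (profile chs) k) (movingSum-shiftBy v lo (ones (length c)) k) ⟨
  movingSum v (chainProfile (chain lo c)) k + movingSum v (profile chs) k
    ≡⟨ movingSum-⊕ v k ⟨
  movingSum v (profile (chain lo c ∷ chs)) k ∎
  where open ≡-Reasoning

-- A chain through the ranks lo, …, lo + ℓ - 1 that is symmetric about R / 2.
SymmetricAbout : ℕ → Chain → Set
SymmetricAbout R (chain lo c) = 1 ≤ length c × 2 * lo + length c ≡ suc R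

hooks-symmetric : ∀ p v {R} lo c → 2 * lo + length c ≡ suc R → All (SymmetricAbout (v + R)) (hooks p v (chain lo c))
hooks-symmetric p v       lo []       _ = []
hooks-symmetric p zero    lo (y ∷ ys) e = (s≤s z≤n , e) ∷ []
hooks-symmetric p (suc v) {R} lo (y ∷ ys) e = (s≤s z≤n , outer) ∷ subst (λ r → All (SymmetricAbout r) (hooks p v (chain (suc lo) ys))) (+-suc v R) inner
  where
  outer : 2 * lo + length (hook p (suc v) y ys) ≡ suc (suc v + R)
  outer = trans (cong (2 * lo +_) (length-hook p (suc v) y ys))
            (trans (rearrange lo v (length ys)) (trans (cong (suc v +_) e) (+-suc (suc v) R)))
    where
    rearrange : ∀ lo v ℓ → 2 * lo + suc (suc v + ℓ) ≡ suc v + (2 * lo + suc ℓ)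
    rearrange = solve-∀
  inner : All (SymmetricAbout (v + suc R)) (hooks p v (chain (suc lo) ys))
  inner = hooks-symmetric p v (suc lo) ys (trans (rearrange lo (length ys)) (cong suc e))
    where
    rearrange : ∀ lo ℓ → 2 * suc lo + ℓ ≡ suc (2 * lo + suc ℓ)
    rearrange = solve-∀

extend-symmetric : ∀ p v {R} chs → All (SymmetricAbout R) chs → All (SymmetricAbout (v + R)) (extend p v chs)
extend-symmetric p v []                 []              = []
extend-symmetric p v (chain lo c ∷ chs) ((_ , e) ∷ syms) = All.++⁺ (hooks-symmetric p v lo c e) (extend-symmetric p v chs syms)

middle-between : ∀ {R lo ℓ} → 1 ≤ ℓ → 2 * lo + ℓ ≡ suc R → lo ≤ ⌊ R /2⌋ × ⌊ R /2⌋ < lo + ℓ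
middle-between {R} {lo} {ℓ} 1≤ℓ e = lo≤m , m<lo+ℓ
  where
  open ≤-Reasoning
  m = ⌊ R /2⌋
  lower = proj₁ (⌊n/2⌋-bounds R)
  upper = proj₂ (⌊n/2⌋-bounds R)
  lo≤m : lo ≤ m
  lo≤m = s≤s⁻¹ (*-cancelˡ-< 2 lo (suc m) (begin-strict
    2 * lo            <⟨ m<m+n (2 * lo) 1≤ℓ ⟩
    2 * lo + ℓ        ≡⟨ e ⟩
    suc R             ≤⟨ s≤s upper ⟩
    suc (suc (m + m)) ≡⟨ cong (λ x → suc (suc (m + x))) (+-identityʳ m) ⟨
    2 + 2 * m         ≡⟨ *-suc 2 m ⟨
    2 * suc m         ∎))
  m<lo+ℓ : m < lo + ℓ
  m<lo+ℓ = *-cancelˡ-< 2 m (lo + ℓ) (begin-strict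
    2 * m             ≡⟨ cong (m +_) (+-identityʳ m) ⟩
    m + m             ≤⟨ lower ⟩
    R                 <⟨ n<1+n R ⟩
    suc R             ≡⟨ e ⟨
    2 * lo + ℓ        ≤⟨ +-monoʳ-≤ (2 * lo) (m≤n*m ℓ 2) ⟩
    2 * lo + 2 * ℓ    ≡⟨ *-distribˡ-+ 2 lo ℓ ⟨
    2 * (lo + ℓ)      ∎)

symmetric-through-middle : ∀ {R} ch → SymmetricAbout R ch → chainProfile ch ⌊ R /2⌋ ≡ 1
symmetric-through-middle {R} (chain lo c) (1≤ℓ , e) with middle-between {R} 1≤ℓ e
... | lo≤m , m<lo+ℓ = begin
  shiftBy lo (ones ℓ) m                  ≡⟨ cong (shiftBy lo (ones ℓ)) (m+[n∸m]≡n lo≤m) ⟨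
  shiftBy lo (ones ℓ) (lo + (m ∸ lo))    ≡⟨ shiftBy-+ lo (ones ℓ) (m ∸ lo) ⟩
  ones ℓ (m ∸ lo)                        ≡⟨ ones-below ℓ (+-cancelˡ-< lo (m ∸ lo) ℓ (subst (_< lo + ℓ) (sym (m+[n∸m]≡n lo≤m)) m<lo+ℓ)) ⟩
  1                                      ∎
  where
  open ≡-Reasoning
  ℓ = length c
  m = ⌊ R /2⌋

length≤profile-middle : ∀ {R} chs → All (SymmetricAbout R) chs → length chs ≤ profile chs ⌊ R /2⌋
length≤profile-middle []         []         = z≤n
length≤profile-middle (ch ∷ chs) (s ∷ syms) =
  subst (λ x → suc (length chs) ≤ x + _) (sym (symmetric-through-middle ch s)) (s≤s (length≤profile-middle chs syms))

Doubling : List ℕ → Set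
Doubling = Linked (λ x y → 2 * x ≤ y)

module _ (p : ℕ) (2≤p : 2 ≤ p) where

  private
    2*-mono : ∀ {x y} → 2 * x ≤ y → 2 * (x * p) ≤ y * p
    2*-mono {x} {y} le = subst (_≤ y * p) (*-assoc 2 x p) (*-monoˡ-≤ p le)

    doubling-*p : ∀ {xs} → Doubling xs → Doubling (map (_* p) xs)
    doubling-*p ds = Linked.map⁺ (Linked.map (λ {x} {y} → 2*-mono {x} {y}) ds)

    cons-hook : ∀ v {x y ys} → 2 * x ≤ y → Doubling (hook p v y ys) → Doubling (x ∷ hook p v y ys)
    cons-hook zero    le ds = le ∷ ds
    cons-hook (suc v) le ds = le ∷ ds

  hook-doubling : ∀ v y ys → Doubling (y ∷ ys) → Doubling (hook p v y ys)
  hook-doubling zero    y ys ds = ds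
  hook-doubling (suc v) y ys ds =
    cons-hook v (subst (_≤ y * p) (*-comm y 2) (*-monoʳ-≤ y 2≤p)) (hook-doubling v (y * p) (map (_* p) ys) (doubling-*p ds))

  hooks-doubling : ∀ v ch → Doubling (elements ch) → All (Doubling ∘ elements) (hooks p v ch)
  hooks-doubling v       (chain lo [])       _  = []
  hooks-doubling zero    (chain lo (y ∷ ys)) ds = ds ∷ []
  hooks-doubling (suc v) (chain lo (y ∷ ys)) ds = hook-doubling (suc v) y ys ds ∷ hooks-doubling v (chain (suc lo) ys) (Linked.tail ds)

  extend-doubling : ∀ v chs → All (Doubling ∘ elements) chs → All (Doubling ∘ elements) (extend p v chs)
  extend-doubling v []         []         = []
  extend-doubling v (ch ∷ chs) (ds ∷ dss) = All.++⁺ (hooks-doubling v ch ds) (extend-doubling v chs dss)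

module _ (p : ℕ) where

  hook-∋-head : ∀ v y ys {a} → a ≤ v → y * p ^ a ∈ hook p v y ys
  hook-∋-head zero    y ys {zero}  _         = here (*-identityʳ y)
  hook-∋-head (suc v) y ys {zero}  _         = here (*-identityʳ y)
  hook-∋-head (suc v) y ys {suc a} (s≤s a≤v) =
    there (subst (_∈ hook p v (y * p) (map (_* p) ys)) (*-assoc y p (p ^ a)) (hook-∋-head v (y * p) (map (_* p) ys) a≤v))

  hook-∋-tail : ∀ v y ys {d} → d ∈ ys → d * p ^ v ∈ hook p v y ys
  hook-∋-tail zero    y ys {d} d∈ys = there (subst (_∈ ys) (sym (*-identityʳ d)) d∈ys)
  hook-∋-tail (suc v) y ys {d} d∈ys =
    there (subst (_∈ hook p v (y * p) (map (_* p) ys)) (*-assoc d p (p ^ v)) (hook-∋-tail v (y * p) (map (_* p) ys) (∈-map⁺ (_* p) d∈ys)))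

  hooks-∋ : ∀ v lo c {d a} → d ∈ c → a ≤ v → Any ((d * p ^ a ∈_) ∘ elements) (hooks p v (chain lo c))
  hooks-∋ zero    lo (y ∷ ys) {a = zero} (here refl)  _   = here (hook-∋-head zero y ys z≤n)
  hooks-∋ zero    lo (y ∷ ys) {a = zero} (there d∈ys) _   = here (hook-∋-tail zero y ys d∈ys)
  hooks-∋ (suc v) lo (y ∷ ys)            (here refl)  a≤v = here (hook-∋-head (suc v) y ys a≤v)
  hooks-∋ (suc v) lo (y ∷ ys) {a = a}    (there d∈ys) a≤v with a ≟ suc v
  ... | yes refl = here (hook-∋-tail (suc v) y ys d∈ys)
  ... | no  a≢v  = there (hooks-∋ v (suc lo) ys d∈ys (s≤s⁻¹ (≤∧≢⇒< a≤v a≢v)))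

  extend-∋ : ∀ v chs {d a} → Any ((d ∈_) ∘ elements) chs → a ≤ v → Any ((d * p ^ a ∈_) ∘ elements) (extend p v chs)
  extend-∋ v (chain lo c ∷ chs) (here d∈c)  a≤v = Any.++⁺ˡ (hooks-∋ v lo c d∈c a≤v)
  extend-∋ v (ch ∷ chs)         (there d∈) a≤v = Any.++⁺ʳ (hooks p v ch) (extend-∋ v chs d∈ a≤v)

InWindow₃ : ℕ → ℕ → Set
InWindow₃ d x = d ≤ x × x < 3 * d

inWindow₃? : ∀ d x → Dec (InWindow₃ d x)
inWindow₃? d x = d ≤? x ×-dec x <? 3 * d

doubling-tail-≥ : ∀ {y zs} → Doubling (y ∷ zs) → All (λ z → 2 * y ≤ z) zs
doubling-tail-≥         [-]       = []
doubling-tail-≥ {y = y} (le ∷ ds) = Linked.Linked⇒All (λ {a} {b} {c} le le′ → ≤-trans le (≤-trans (m≤n*m b 2) le′)) {v = y} le ds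

-- After an element x ≥ d of a doubling list come only elements ≥ 4x ≥ 4d > 3d.
doubling-window : ∀ d {xs} → Doubling xs → length (filter (inWindow₃? d) xs) ≤ 2
doubling-window d [] =  z≤n
doubling-window d {x ∷ []} [-] = ≤-trans (length-filter (inWindow₃? d) (x ∷ [])) (s≤s z≤n)
doubling-window d {x ∷ y ∷ zs} (2x≤y ∷ ds) = by-cases (inWindow₃? d x)
  where
  W? = inWindow₃? d
  by-cases : Dec (InWindow₃ d x) → length (filter W? (x ∷ y ∷ zs)) ≤ 2
  by-cases (no x∉) = subst (λ l → length l ≤ 2) (sym (filter-reject W? x∉)) (doubling-window d ds)
  by-cases (yes (d≤x , x<3d)) = subst (λ l → length l ≤ 2) (sym (filter-accept W? (d≤x , x<3d))) (s≤s (at-most-one (W? y)))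
    where
    beyond : All (λ z → ¬ InWindow₃ d z) zs
    beyond = All.map (λ {z} 2y≤z (_ , z<3d) → <⇒≱ z<3d (begin
        3 * d            ≤⟨ *-monoʳ-≤ 3 d≤x ⟩
        3 * x            ≤⟨ m≤m+n (3 * x) x ⟩
        3 * x + x        ≡⟨ 3x+x≡2[2x] x ⟩
        2 * (2 * x)      ≤⟨ *-monoʳ-≤ 2 2x≤y ⟩
        2 * y            ≤⟨ 2y≤z ⟩
        z                ∎))
      (doubling-tail-≥ ds)
      where
      open ≤-Reasoning
      3x+x≡2[2x] : ∀ x → 3 * x + x ≡ 2 * (2 * x)
      3x+x≡2[2x] = solve-∀
    none : filter W? zs ≡ []
    none = filter-none W? beyond
    at-most-one : Dec (InWindow₃ d y) → length (filter W? (y ∷ zs)) ≤ 1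
    at-most-one (yes y∈) = subst (λ l → length l ≤ 1) (sym (trans (filter-accept W? y∈) (cong (y ∷_) none))) ≤-refl
    at-most-one (no  y∉) = subst (λ l → length l ≤ 1) (sym (trans (filter-reject W? y∉) none)) z≤n

window-in-chains : ∀ d chs → All (Doubling ∘ elements) chs →
                   length (filter (inWindow₃? d) (concatMap elements chs)) ≤ 2 * length chs
window-in-chains d []         []         = z≤n
window-in-chains d (ch ∷ chs) (ds ∷ dss) = begin
  length (filter W? (elements ch ++ concatMap elements chs))
    ≡⟨ cong length (filter-++ W? (elements ch) (concatMap elements chs)) ⟩
  length (filter W? (elements ch) ++ filter W? (concatMap elements chs))
    ≡⟨ length-++ (filter W? (elements ch)) ⟩
  length (filter W? (elements ch)) + length (filter W? (concatMap elements chs))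
    ≤⟨ +-mono-≤ (doubling-window d ds) (window-in-chains d chs dss) ⟩
  2 + 2 * length chs
    ≡⟨ *-suc 2 (length chs) ⟨
  2 * length (ch ∷ chs) ∎
  where
  open ≤-Reasoning
  W? = inWindow₃? d

unique-⊆⇒length≤ : ∀ {A : Set} (xs ys : List A) → Unique xs → (∀ {x} → x ∈ xs → x ∈ ys) → length xs ≤ length ys
unique-⊆⇒length≤ []       ys _             _   = z≤n
unique-⊆⇒length≤ (x ∷ xs) ys (x∉xs ∷ uxs) sub with ∈-∃++ (sub (here refl))
... | us , vs , refl = begin
  suc (length xs)             ≤⟨ s≤s (unique-⊆⇒length≤ xs (us ++ vs) uxs sub′) ⟩
  suc (length (us ++ vs))     ≡⟨ cong suc (length-++ us) ⟩
  suc (length us + length vs) ≡⟨ +-suc (length us) (length vs) ⟨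
  length us + suc (length vs) ≡⟨ length-++ us ⟨
  length (us ++ x ∷ vs)       ∎
  where
  open ≤-Reasoning
  sub′ : ∀ {y} → y ∈ xs → y ∈ us ++ vs
  sub′ {y} y∈xs with ∈-++⁻ us (sub (there y∈xs))
  ... | inj₁ y∈us         = ∈-++⁺ˡ y∈us
  ... | inj₂ (here refl)  = ⊥-elim (All.lookup x∉xs y∈xs refl)
  ... | inj₂ (there y∈vs) = ∈-++⁺ʳ us y∈vs

-- Prime powers, τ and Ω₂

prime⇒2≤ : ∀ {p} → Prime p → 2 ≤ p
prime⇒2≤ {p} p-prime = nonTrivial⇒n>1 p {{prime⇒nonTrivial p-prime}}

n<m^n : ∀ {m} → 1 < m → ∀ n → n < m ^ n
n<m^n 1<m zero    = s≤s z≤n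
n<m^n {m} 1<m (suc n) = begin-strict
  suc n          <⟨ s<s (n<m^n 1<m n) ⟩
  suc (m ^ n)    ≤⟨ m<m+n (m ^ n) (m^n>0 m n) ⟩
  m ^ n + m ^ n  ≡⟨ cong (m ^ n +_) (+-identityʳ (m ^ n)) ⟨
  2 * m ^ n      ≤⟨ *-monoˡ-≤ (m ^ n) 1<m ⟩
  m * m ^ n      ∎
  where
  open ≤-Reasoning
  instance _ = >-nonZero (<-trans z<s 1<m)

module _ {p : ℕ} (2≤p : 2 ≤ p) where

  private instance
    p≢0 : NonZero p
    p≢0 = >-nonZero (<-trans z<s 2≤p)

  split-power : ∀ x → .{{NonZero x}} → ∃₂ λ a d → ¬ p ∣ d × x ≡ d * p ^ a
  split-power x = go x (<-wellFounded x)
    where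
    go : ∀ x → .{{NonZero x}} → Acc _<_ x → ∃₂ λ a d → ¬ p ∣ d × x ≡ d * p ^ a
    go x (acc smaller) with p ∣? x
    ... | no  p∤x = 0 , x , p∤x , sym (*-identityʳ x)
    ... | yes (divides q x≡qp) with go q {{q≢0}} (smaller q<x)
      where
      q≢0 : NonZero q
      q≢0 = ≢-nonZero λ { refl → ≢-nonZero⁻¹ x x≡qp }
      q<x : q < x
      q<x = subst (q <_) (sym x≡qp) (subst (_< q * p) (*-identityʳ q) (*-monoʳ-< q {{q≢0}} 2≤p))
    ...   | a , d , p∤d , q≡dpᵃ = suc a , d , p∤d , trans x≡qp (trans (cong (_* p) q≡dpᵃ) (sym (x*[y*z]≡x*z*y d p (p ^ a))))

  power-split-unique : ∀ {d d′} → ¬ p ∣ d → ¬ p ∣ d′ → ∀ a b → d * p ^ a ≡ d′ * p ^ b → d ≡ d′ × a ≡ b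
  power-split-unique {d} {d′} _ _ zero zero eq = trans (sym (*-identityʳ d)) (trans eq (*-identityʳ d′)) , refl
  power-split-unique {d} {d′} p∤d _ zero (suc b) eq =
    ⊥-elim (p∤d (divides (d′ * p ^ b) (trans (sym (*-identityʳ d)) (trans eq (x*[y*z]≡x*z*y d′ p (p ^ b))))))
  power-split-unique {d} {d′} _ p∤d′ (suc a) zero eq =
    ⊥-elim (p∤d′ (divides (d * p ^ a) (trans (sym (*-identityʳ d′)) (trans (sym eq) (x*[y*z]≡x*z*y d p (p ^ a))))))
  power-split-unique {d} {d′} p∤d p∤d′ (suc a) (suc b) eq with power-split-unique p∤d p∤d′ a b
      (*-cancelʳ-≡ (d * p ^ a) (d′ * p ^ b) p (trans (sym (x*[y*z]≡x*z*y d p (p ^ a))) (trans eq (x*[y*z]≡x*z*y d′ p (p ^ b)))))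
  ... | d≡d′ , a≡b = d≡d′ , cong suc a≡b

module _ {p : ℕ} (p-prime : Prime p) where

  private instance
    p≢0 : NonZero p
    p≢0 = prime⇒nonZero p-prime

  ∤⇒coprime : ∀ {x} → ¬ p ∣ x → Coprime x p
  ∤⇒coprime p∤x (i∣x , i∣p) with prime⇒irreducible p-prime i∣p
  ... | inj₁ i≡1 = i≡1
  ... | inj₂ i≡p = ⊥-elim (p∤x (subst (_∣ _) i≡p i∣x))

  coprime-∣-*-power : ∀ {d} m → Coprime d p → ∀ v → d ∣ m * p ^ v → d ∣ m
  coprime-∣-*-power {d} m coprime zero    d∣m = subst (d ∣_) (*-identityʳ m) d∣m
  coprime-∣-*-power {d} m coprime (suc v) d∣ =
    coprime-∣-*-power m coprime v (coprime-divisor coprime (subst (d ∣_) (x*[y*z]≡y*[x*z] m p (p ^ v)) d∣))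

  power-∣-bound : ∀ {m} → ¬ p ∣ m → ∀ a v → p ^ a ∣ m * p ^ v → a ≤ v
  power-∣-bound {m} p∤m a v pᵃ∣ with a ≤? v
  ... | yes a≤v = a≤v
  ... | no  a≰v = ⊥-elim (p∤m (*-cancelˡ-∣ (p ^ v) {{m^n≢0 p v}} (subst₂ _∣_ (*-comm p (p ^ v)) (*-comm m (p ^ v)) (∣-trans pˢᵘᶜᵛ∣pᵃ pᵃ∣))))
    where
    pˢᵘᶜᵛ∣pᵃ : p ^ suc v ∣ p ^ a
    pˢᵘᶜᵛ∣pᵃ = subst (λ e → p ^ suc v ∣ p ^ e) (m+[n∸m]≡n (≰⇒> a≰v))
                 (subst (p ^ suc v ∣_) (sym (^-distribˡ-+-* p (suc v) (a ∸ suc v))) (m∣m*n _))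

  divisor-split : ∀ {m x} v → ¬ p ∣ m → .{{NonZero m}} → x ∣ m * p ^ v → ∃₂ λ a d → a ≤ v × d ∣ m × x ≡ d * p ^ a
  divisor-split {m} {x} v p∤m {{m≢0}} x∣n with split-power (prime⇒2≤ p-prime) x {{x≢0}}
    where
    x≢0 : NonZero x
    x≢0 = ≢-nonZero λ { refl → ≢-nonZero⁻¹ (m * p ^ v) {{m*n≢0 m (p ^ v) {{m≢0}} {{m^n≢0 p v}}}} (0∣⇒≡0 x∣n) }
  ... | a , d , p∤d , x≡dpᵃ = a , d , a≤v , d∣m , x≡dpᵃ
    where
    a≤v = power-∣-bound p∤m a v (∣-trans (divides d x≡dpᵃ) x∣n)
    d∣m = coprime-∣-*-power m (∤⇒coprime p∤d) v (∣-trans (divides (p ^ a) (trans x≡dpᵃ (*-comm d (p ^ a)))) x∣n)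

  ∤-power-of-other-prime : ∀ {q} → Prime q → q ≢ p → ∀ j → ¬ p ∣ q ^ j
  ∤-power-of-other-prime {q} _       q≢p zero    p∣1 = <⇒≢ (prime⇒2≤ p-prime) (sym (∣1⇒≡1 p∣1))
  ∤-power-of-other-prime {q} q-prime q≢p (suc j) p∣ with euclidsLemma q (q ^ j) p-prime p∣
  ... | inj₂ p∣qʲ = ∤-power-of-other-prime q-prime q≢p j p∣qʲ
  ... | inj₁ p∣q with prime⇒irreducible q-prime p∣q
  ...   | inj₁ p≡1 = <⇒≢ (prime⇒2≤ p-prime) (sym p≡1)
  ...   | inj₂ p≡q = q≢p (sym p≡q)

χ : ∀ {A : Set} → Dec A → ℕ
χ (yes _) = 1
χ (no  _) = 0

χ-mono : ∀ {A B : Set} → (A → B) → (a : Dec A) (b : Dec B) → χ a ≤ χ b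
χ-mono A⇒B (yes a) (yes _) = ≤-refl
χ-mono A⇒B (yes a) (no ¬b) = ⊥-elim (¬b (A⇒B a))
χ-mono A⇒B (no _)  _       = z≤n

χ-no : ∀ {A : Set} → ¬ A → (a : Dec A) → χ a ≡ 0
χ-no ¬a (yes a) = ⊥-elim (¬a a)
χ-no ¬a (no _)  = refl

χ≤1 : ∀ {A : Set} (a : Dec A) → χ a ≤ 1
χ≤1 (yes _) = ≤-refl
χ≤1 (no _)  = z≤n

module _ {P : ℕ → Set} (P? : Decidable P) where

  private
    range1≡ : ∀ n → range1 n ≡ applyUpTo suc n
    range1≡ n = map-applyUpTo id suc n

    length-filter-applyUpTo : ∀ f n → length (filter P? (applyUpTo f n)) ≡ ∑[ k < n ] χ (P? (f k))
    length-filter-applyUpTo f zero    = refl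
    length-filter-applyUpTo f (suc n) with P? (f 0)
    ... | yes _ = cong suc (length-filter-applyUpTo (f ∘ suc) n)
    ... | no  _ = length-filter-applyUpTo (f ∘ suc) n

    sum-filter-applyUpTo : ∀ (g : ℕ → ℕ) f n → sum (map g (filter P? (applyUpTo f n))) ≡ ∑[ k < n ] χ (P? (f k)) * g (f k)
    sum-filter-applyUpTo g f zero    = refl
    sum-filter-applyUpTo g f (suc n) with P? (f 0)
    ... | yes _ = cong₂ _+_ (sym (+-identityʳ (g (f 0)))) (sum-filter-applyUpTo g (f ∘ suc) n)
    ... | no  _ = sum-filter-applyUpTo g (f ∘ suc) n

  length-filter-range1 : ∀ n → length (filter P? (range1 n)) ≡ ∑[ k < n ] χ (P? (suc k))
  length-filter-range1 n = trans (cong (length ∘ filter P?) (range1≡ n)) (length-filter-applyUpTo suc n)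

  sum-filter-range1 : ∀ (g : ℕ → ℕ) n → sum (map g (filter P? (range1 n))) ≡ ∑[ k < n ] χ (P? (suc k)) * g (suc k)
  sum-filter-range1 g n = trans (cong (sum ∘ map g ∘ filter P?) (range1≡ n)) (sum-filter-applyUpTo g suc n)

val-as-∑ : ∀ q n → val q n ≡ ∑[ k < n ] χ (q ^ suc k ∣? n)
val-as-∑ q n = length-filter-range1 (λ k → q ^ k ∣? n) n

Ω₂-as-∑ : ∀ n → Ω₂ n ≡ ∑[ k < n ] χ (prime? (suc k)) * val (suc k) n ²
Ω₂-as-∑ n = sum-filter-range1 prime? (λ p → val p n ²) n

-- q^(k+1) > k + 1 > m, so only k < m can contribute: the range of val can be extended.
val-extend : ∀ {q m N} → 1 < q → .{{NonZero m}} → m ≤ N → ∑[ k < N ] χ (q ^ suc k ∣? m) ≡ val q m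
val-extend {q} {m} {N} 1<q m≤N = trans (∑-beyond-support _ beyond m≤N) (sym (val-as-∑ q m))
  where
  beyond : ∀ k → m ≤ k → χ (q ^ suc k ∣? m) ≡ 0
  beyond k m≤k = χ-no (λ qᵏ⁺¹∣m → <⇒≱ (≤-<-trans m≤k (<-trans (n<1+n k) (n<m^n 1<q (suc k)))) (∣⇒≤ qᵏ⁺¹∣m)) (q ^ suc k ∣? m)

val-above : ∀ {q m} → m < q → val q m ≡ 0
val-above {q} {zero}  _   = refl
val-above {q} {suc m} m<q = trans (val-as-∑ q (suc m)) (∑-vanishing (suc m) λ k _ →
  χ-no (λ qᵏ⁺¹∣m → <⇒≱ (<-≤-trans m<q (qᵏ⁺¹≥q k)) (∣⇒≤ qᵏ⁺¹∣m)) (q ^ suc k ∣? suc m))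
  where
  instance _ = >-nonZero (<-≤-trans z<s m<q)
  qᵏ⁺¹≥q : ∀ k → q ≤ q ^ suc k
  qᵏ⁺¹≥q k = subst (_≤ q ^ suc k) (*-identityʳ q) (*-monoʳ-≤ q (m^n>0 q k))

∑χ[a+k≡p]≤1 : ∀ N a p → ∑[ k < N ] χ (a + k ≟ p) ≤ 1
∑χ[a+k≡p]≤1 zero    a p = z≤n
∑χ[a+k≡p]≤1 (suc N) a p with a + 0 ≟ p
... | yes a≡p = ≤-reflexive (cong suc (∑-vanishing N λ k _ →
                  χ-no (λ a+sk≡p → 1+n≢0 (+-cancelˡ-≡ a (suc k) 0 (trans a+sk≡p (sym a≡p)))) (a + suc k ≟ p)))
... | no  _   = subst (_≤ 1) (∑-cong N λ k _ → cong (λ x → χ (x ≟ p)) (sym (+-suc a k))) (∑χ[a+k≡p]≤1 N (suc a) p)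

∑χ[1+k≤v]≤v : ∀ N v → ∑[ k < N ] χ (suc k ≤? v) ≤ v
∑χ[1+k≤v]≤v zero    v       = z≤n
∑χ[1+k≤v]≤v (suc N) zero    = ≤-reflexive (∑-vanishing N λ _ _ → refl)
∑χ[1+k≤v]≤v (suc N) (suc v) =
  s≤s (≤-trans (∑-mono-≤ N λ k _ → χ-mono s≤s⁻¹ (suc (suc k) ≤? suc v) (suc k ≤? v)) (∑χ[1+k≤v]≤v N v))

divisors : ℕ → List ℕ
divisors n = filter (_∣? n) (range1 n)

divisors-unique : ∀ n → Unique (divisors n)
divisors-unique n = Unique.filter⁺ (_∣? n) (Unique.map⁺ suc-injective (Unique.upTo⁺ n))

∈-divisors : ∀ {n x} → .{{NonZero n}} → x ∣ n → x ∈ divisors n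
∈-divisors {n} {zero}  0∣n = ⊥-elim (≢-nonZero⁻¹ n (0∣⇒≡0 0∣n))
∈-divisors {n} {suc x} x∣n = ∈-filter⁺ (_∣? n) (∈-map⁺ suc (∈-upTo⁺ (∣⇒≤ x∣n))) x∣n

unique-divisors≤τ : ∀ {n} xs → .{{NonZero n}} → Unique xs → All (_∣ n) xs → length xs ≤ τ n
unique-divisors≤τ xs uxs xs∣n = unique-⊆⇒length≤ xs _ uxs (λ x∈xs → ∈-divisors (All.lookup xs∣n x∈xs))

module _ {p : ℕ} (p-prime : Prime p) (v : ℕ) where

  powerMultiples : ℕ → List ℕ
  powerMultiples d = map (λ a → d * p ^ a) (upTo (suc v))

  ∈-powerMultiples⁻ : ∀ {d x} → x ∈ powerMultiples d → ∃[ a ] (a ≤ v × x ≡ d * p ^ a)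
  ∈-powerMultiples⁻ {d} x∈ with ∈-map⁻ (λ a → d * p ^ a) x∈
  ... | a , a∈ , x≡dpᵃ = a , s≤s⁻¹ (∈-upTo⁻ a∈) , x≡dpᵃ

  length-concatMap-powerMultiples : ∀ ds → length (concatMap powerMultiples ds) ≡ suc v * length ds
  length-concatMap-powerMultiples []       = sym (*-zeroʳ (suc v))
  length-concatMap-powerMultiples (d ∷ ds) = begin
    length (powerMultiples d ++ concatMap powerMultiples ds)          ≡⟨ length-++ (powerMultiples d) ⟩
    length (powerMultiples d) + length (concatMap powerMultiples ds)  ≡⟨ cong₂ _+_ (trans (length-map _ (upTo (suc v))) (length-upTo (suc v)))
                                                                                   (length-concatMap-powerMultiples ds) ⟩
    suc v + suc v * length ds                                         ≡⟨ *-suc (suc v) (length ds) ⟨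
    suc v * length (d ∷ ds)                                           ∎
    where open ≡-Reasoning

  unique-concatMap-powerMultiples : ∀ {ds} → Unique ds → All (λ d → ¬ p ∣ d) ds → Unique (concatMap powerMultiples ds)
  unique-concatMap-powerMultiples []             []             = []
  unique-concatMap-powerMultiples {d ∷ ds} (d∉ds ∷ uds) (p∤d ∷ p∤ds) =
    Unique.++⁺ (Unique.map⁺ (λ {a} {b} eq → proj₂ (power-split-unique 2≤p p∤d p∤d a b eq)) (Unique.upTo⁺ (suc v)))
               (unique-concatMap-powerMultiples uds p∤ds) disjoint
    where
    2≤p = prime⇒2≤ p-prime
    disjoint : Disjoint (powerMultiples d) (concatMap powerMultiples ds)
    disjoint (x∈ , x∈′) with ∈-powerMultiples⁻ {d} x∈ | find (Any.map⁻ (∈-concat⁻ (map powerMultiples ds) x∈′))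
    ... | a , _ , x≡dpᵃ | d′ , d′∈ds , x∈″ with ∈-powerMultiples⁻ {d′} x∈″
    ...   | b , _ , x≡d′pᵇ = All.lookup d∉ds d′∈ds
            (proj₁ (power-split-unique 2≤p p∤d (All.lookup p∤ds d′∈ds) a b (trans (sym x≡dpᵃ) x≡d′pᵇ)))

  powerMultiples-∣ : ∀ {m d x} → d ∣ m → x ∈ powerMultiples d → x ∣ m * p ^ v
  powerMultiples-∣ {m} {d} d∣m x∈ with ∈-powerMultiples⁻ {d} x∈
  ... | a , a≤v , refl = *-pres-∣ d∣m (subst (p ^ a ∣_) (sym (trans (cong (p ^_) (sym (m+[n∸m]≡n a≤v))) (^-distribˡ-+-* p a (v ∸ a)))) (m∣m*n (p ^ (v ∸ a))))

module _ {p m : ℕ} (p-prime : Prime p) (p∤m : ¬ p ∣ m) .{{_ : NonZero m}} (v : ℕ) where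

  private
    n = m * p ^ v
    instance
      pᵛ≢0 : NonZero (p ^ v)
      pᵛ≢0 = m^n≢0 p v {{prime⇒nonZero p-prime}}
      n≢0 : NonZero n
      n≢0 = m*n≢0 m (p ^ v)
    m≤n : m ≤ n
    m≤n = m≤m*n m (p ^ v)

    val-other-prime : ∀ {q} → Prime q → q ≢ p → val q n ≤ val q m
    val-other-prime {q} q-prime q≢p = begin
      val q n                          ≡⟨ val-as-∑ q n ⟩
      ∑[ k < n ] χ (q ^ suc k ∣? n)    ≤⟨ ∑-mono-≤ n (λ k _ → χ-mono (cancel-pᵛ k) (q ^ suc k ∣? n) (q ^ suc k ∣? m)) ⟩
      ∑[ k < n ] χ (q ^ suc k ∣? m)    ≡⟨ val-extend (prime⇒2≤ q-prime) m≤n ⟩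
      val q m                          ∎
      where
      open ≤-Reasoning
      cancel-pᵛ : ∀ k → q ^ suc k ∣ n → q ^ suc k ∣ m
      cancel-pᵛ k = coprime-∣-*-power p-prime m (∤⇒coprime p-prime (∤-power-of-other-prime p-prime q-prime q≢p (suc k))) v

    val-p : val p n ≤ v
    val-p = begin
      val p n                          ≡⟨ val-as-∑ p n ⟩
      ∑[ k < n ] χ (p ^ suc k ∣? n)    ≤⟨ ∑-mono-≤ n (λ k _ → χ-mono (power-∣-bound p-prime p∤m (suc k) v) (p ^ suc k ∣? n) (suc k ≤? v)) ⟩
      ∑[ k < n ] χ (suc k ≤? v)        ≤⟨ ∑χ[1+k≤v]≤v n v ⟩
      v                                ∎
      where open ≤-Reasoning

    term-bound : ∀ q → χ (prime? q) * val q n ² ≤ χ (prime? q) * val q m ² + χ (q ≟ p) * v ²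
    term-bound q with q ≟ p
    ... | yes refl = ≤-trans (*-mono-≤ (χ≤1 (prime? p)) (²-mono-≤ val-p)) (m≤n+m (1 * v ²) (χ (prime? p) * val p m ²))
    ... | no  q≢p with prime? q
    ...   | yes q-prime = ≤-trans (*-monoʳ-≤ 1 (²-mono-≤ (val-other-prime q-prime q≢p))) (m≤m+n _ _)
    ...   | no  _      = z≤n

  τ-*-prime-power : suc v * τ m ≤ τ (m * p ^ v)
  τ-*-prime-power = begin
    suc v * τ m        ≡⟨ length-concatMap-powerMultiples p-prime v (divisors m) ⟨
    length multiples   ≤⟨ unique-divisors≤τ multiples multiples-unique multiples-∣ ⟩
    τ n                ∎
    where
    open ≤-Reasoning
    multiples = concatMap (powerMultiples p-prime v) (divisors m)
    divisor : ∀ {d} → d ∈ divisors m → d ∣ m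
    divisor d∈ = proj₂ (∈-filter⁻ (_∣? m) {xs = range1 m} d∈)
    multiples-unique : Unique multiples
    multiples-unique = unique-concatMap-powerMultiples p-prime v (divisors-unique m)
      (All.tabulate λ d∈ p∣d → p∤m (∣-trans p∣d (divisor d∈)))
    multiples-∣ : All (_∣ n) multiples
    multiples-∣ = All.tabulate λ x∈ →
      let d , d∈ , x∈′ = find (Any.map⁻ (∈-concat⁻ (map (powerMultiples p-prime v) (divisors m)) x∈))
      in  powerMultiples-∣ p-prime v (divisor d∈) x∈′

  Ω₂-*-prime-power : Ω₂ (m * p ^ v) ≤ v ² + Ω₂ m
  Ω₂-*-prime-power = begin
    Ω₂ n
      ≡⟨ Ω₂-as-∑ n ⟩
    ∑[ k < n ] χ (prime? (suc k)) * val (suc k) n ²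
      ≤⟨ ∑-mono-≤ n (λ k _ → term-bound (suc k)) ⟩
    ∑[ k < n ] (χ (prime? (suc k)) * val (suc k) m ² + χ (suc k ≟ p) * v ²)
      ≡⟨ ∑-distrib-+ n (λ k → χ (prime? (suc k)) * val (suc k) m ²) (λ k → χ (suc k ≟ p) * v ²) ⟩
    ∑[ k < n ] χ (prime? (suc k)) * val (suc k) m ² + ∑[ k < n ] χ (suc k ≟ p) * v ²
      ≤⟨ +-mono-≤ (≤-reflexive Ω₂-m) p-term ⟩
    Ω₂ m + v ²
      ≡⟨ +-comm (Ω₂ m) (v ²) ⟩
    v ² + Ω₂ m ∎
    where
    open ≤-Reasoning
    Ω₂-m : ∑[ k < n ] χ (prime? (suc k)) * val (suc k) m ² ≡ Ω₂ m
    Ω₂-m = trans (∑-beyond-support _ (λ k m≤k → trans (cong (λ x → χ (prime? (suc k)) * x ²) (val-above (s≤s m≤k))) (*-zeroʳ (χ (prime? (suc k))))) m≤n)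
                 (sym (Ω₂-as-∑ m))
    p-term : ∑[ k < n ] χ (suc k ≟ p) * v ² ≤ v ²
    p-term = begin
      ∑[ k < n ] χ (suc k ≟ p) * v ²     ≡⟨ ∑-cong n (λ k _ → *-comm (χ (suc k ≟ p)) (v ²)) ⟩
      ∑[ k < n ] v ² * χ (suc k ≟ p)     ≡⟨ ∑-distribˡ-* n (v ²) (λ k → χ (suc k ≟ p)) ⟩
      v ² * (∑[ k < n ] χ (suc k ≟ p))   ≤⟨ *-monoʳ-≤ (v ²) (∑χ[a+k≡p]≤1 n 1 p) ⟩
      v ² * 1                            ≡⟨ *-identityʳ (v ²) ⟩
      v ²                                ∎

-- Divisors in a window

eNum<3*! : ∀ k → suc (eNum k) ≤ 3 * k !
eNum<3*! zero          = s≤s (s≤s z≤n)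
eNum<3*! (suc zero)    = ≤-refl
eNum<3*! (suc (suc k)) = begin
  suc ((2 + k) * E + 1)        ≡⟨ +-suc ((2 + k) * E) 1 ⟨
  (2 + k) * E + 2              ≤⟨ +-monoʳ-≤ ((2 + k) * E) (s≤s (s≤s z≤n)) ⟩
  (2 + k) * E + (2 + k)        ≡⟨ +-comm ((2 + k) * E) (2 + k) ⟩
  (2 + k) + (2 + k) * E        ≡⟨ *-suc (2 + k) E ⟨
  (2 + k) * suc E              ≤⟨ *-monoʳ-≤ (2 + k) (eNum<3*! (suc k)) ⟩
  (2 + k) * (3 * suc k !)      ≡⟨ x*[3*y]≡3*[x*y] (2 + k) (suc k !) ⟩
  3 * (2 + k) !                ∎
  where
  open ≤-Reasoning
  E = eNum (suc k)
  x*[3*y]≡3*[x*y] : ∀ x y → x * (3 * y) ≡ 3 * (x * y)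
  x*[3*y]≡3*[x*y] = solve-∀

LtETimes⇒<3* : ∀ {x d} → LtETimes x d → x < 3 * d
LtETimes⇒<3* {x} {d} (k , x*k!<d*eNum) = *-cancelʳ-< (k !) x (3 * d) (begin-strict
  x * k !         <⟨ x*k!<d*eNum ⟩
  d * eNum k      ≤⟨ *-monoʳ-≤ d (≤-trans (n≤1+n _) (eNum<3*! k)) ⟩
  d * (3 * k !)   ≡⟨ *-assoc d 3 (k !) ⟨
  d * 3 * k !     ≡⟨ cong (_* k !) (*-comm d 3) ⟩
  3 * d * k !     ∎)
  where open ≤-Reasoning

record DivisorChains (n : ℕ) : Set where
  field
    exponents : List ℕ
    chains    : List Chain
    doubling  : All (Doubling ∘ elements) chains
    symmetric : All (SymmetricAbout (sum exponents)) chains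
    covering  : ∀ {x} → x ∣ n → Any ((x ∈_) ∘ elements) chains
    profile≗  : profile chains ≗ rankSizes exponents
    τ-bound   : product (map suc exponents) ≤ τ n
    Ω₂-bound  : Ω₂ n ≤ spread exponents

divisorChains-1 : DivisorChains 1
divisorChains-1 = record
  { exponents = []
  ; chains    = chain 0 (1 ∷ []) ∷ []
  ; doubling  = [-] ∷ []
  ; symmetric = (s≤s z≤n , refl) ∷ []
  ; covering  = λ x∣1 → here (here (∣1⇒≡1 x∣1))
  ; profile≗  = λ { zero → refl ; (suc k) → refl }
  ; τ-bound   = ≤-refl
  ; Ω₂-bound  = z≤n
  }

divisorChains-*-prime-power : ∀ {p m} → Prime p → ¬ p ∣ m → .{{NonZero m}} → ∀ v → DivisorChains m → DivisorChains (m * p ^ v)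
divisorChains-*-prime-power {p} {m} p-prime p∤m v dc = record
  { exponents = v ∷ exponents
  ; chains    = extend p v chains
  ; doubling  = extend-doubling p (prime⇒2≤ p-prime) v chains doubling
  ; symmetric = extend-symmetric p v chains symmetric
  ; covering  = covering′
  ; profile≗  = λ k → trans (profile-extend p v chains k) (movingSum-cong v profile≗ k)
  ; τ-bound   = ≤-trans (*-monoʳ-≤ (suc v) τ-bound) (τ-*-prime-power p-prime p∤m v)
  ; Ω₂-bound  = ≤-trans (Ω₂-*-prime-power p-prime p∤m v) (+-mono-≤ (*-monoʳ-≤ v (m≤m+n v 2)) Ω₂-bound)
  }
  where
  open DivisorChains dc
  covering′ : ∀ {x} → x ∣ m * p ^ v → Any ((x ∈_) ∘ elements) (extend p v chains)
  covering′ x∣n with divisor-split p-prime v p∤m x∣n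
  ... | a , d , a≤v , d∣m , refl = extend-∋ p v chains (covering d∣m) a≤v

private
  prime-factor : ∀ n → 2 ≤ n → ∃[ p ] (Prime p × p ∣ n)
  prime-factor 1 (s≤s ())
  prime-factor n@(suc (suc _)) _ with factorise n
  ... | record { factors = [] ; isFactorisation = () }
  ... | record { factors = p ∷ ps ; isFactorisation = n≡ ; factorsPrime = p-prime ∷ _ } =
    p , p-prime , divides (product ps) (trans n≡ (*-comm p (product ps)))

divisorChains : ∀ n → .{{NonZero n}} → DivisorChains n
divisorChains n = go n (<-wellFounded n)
  where
  go : ∀ n → .{{NonZero n}} → Acc _<_ n → DivisorChains n
  go 1               _             = divisorChains-1
  go n@(suc (suc _)) (acc smaller) with prime-factor n (s≤s (s≤s z≤n))
  ... | p , p-prime , p∣n with split-power (prime⇒2≤ p-prime) n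
  ... | v , m , p∤m , n≡m*pᵛ = subst DivisorChains (sym n≡m*pᵛ)
          (divisorChains-*-prime-power p-prime p∤m {{m≢0}} v (go m {{m≢0}} (smaller m<n)))
    where
    m≢0 : NonZero m
    m≢0 = ≢-nonZero λ { refl → 1+n≢0 n≡m*pᵛ }
    v≢0 : NonZero v
    v≢0 = ≢-nonZero λ { refl → p∤m (subst (p ∣_) (trans n≡m*pᵛ (*-identityʳ m)) p∣n) }
    m<n : m < n
    m<n = subst (m <_) (sym n≡m*pᵛ) (subst (_< m * p ^ v) (*-identityʳ m)
            (*-monoʳ-< m {{m≢0}} (^-monoʳ-< p (prime⇒2≤ p-prime) (>-nonZero⁻¹ v {{v≢0}}))))

windowed-divisors≤ : ∀ {n d S} (dc : DivisorChains n) → Unique S → All (InWindow n d) S →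
  length S ≤ 2 * rankSizes (DivisorChains.exponents dc) ⌊ sum (DivisorChains.exponents dc) /2⌋
windowed-divisors≤ {n} {d} {S} dc unique-S S-in-window = begin
  length S                                              ≤⟨ unique-⊆⇒length≤ S _ unique-S S⊆ ⟩
  length (filter (inWindow₃? d) (concatMap elements chains)) ≤⟨ window-in-chains d chains doubling ⟩
  2 * length chains                                     ≤⟨ *-monoʳ-≤ 2 (length≤profile-middle chains symmetric) ⟩
  2 * profile chains m                                  ≡⟨ cong (2 *_) (profile≗ m) ⟩
  2 * rankSizes exponents m                             ∎
  where
  open ≤-Reasoning
  open DivisorChains dc
  m = ⌊ sum exponents /2⌋
  S⊆ : ∀ {x} → x ∈ S → x ∈ filter (inWindow₃? d) (concatMap elements chains)
  S⊆ {x} x∈S with All.lookup S-in-window x∈S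
  ... | x∣n , d≤x , x<ed = ∈-filter⁺ (inWindow₃? d) (∈-concat⁺ (Any.map⁺ (covering x∣n))) (d≤x , LtETimes⇒<3* {x} {d} x<ed)

lemma6 : ∃ λ (C : ℕ) → ∀ (n : ℕ) → 2 ≤ n → ∀ (d : ℕ) → d ∣ n → ∀ (S : List ℕ) → Unique S → All (InWindow n d) S → length S ^ 2 * Ω₂ n ≤ C * τ n ^ 2
lemma6 = 9240 , bound
  where
  -- The bound holds for every d.
  bound : ∀ n → 2 ≤ n → ∀ d → d ∣ n → ∀ S → Unique S → All (InWindow n d) S → length S ^ 2 * Ω₂ n ≤ 9240 * τ n ^ 2
  bound n 2≤n d _ S unique-S S-in-window = begin
    length S ^ 2 * Ω₂ n                            ≡⟨ cong (λ x → length S * x * Ω₂ n) (*-identityʳ (length S)) ⟩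
    length S ² * Ω₂ n                              ≤⟨ *-mono-≤ (²-mono-≤ (windowed-divisors≤ dc unique-S S-in-window)) Ω₂-bound ⟩
    (2 * t) ² * spread exponents                   ≡⟨ regroup t (spread exponents) ⟩
    4 * (t ² * spread exponents)                   ≤⟨ *-monoʳ-≤ 4 (rankSizes-centre-bound exponents) ⟩
    4 * (2310 * product (map suc exponents) ²)     ≤⟨ *-monoʳ-≤ 4 (*-monoʳ-≤ 2310 (²-mono-≤ τ-bound)) ⟩
    4 * (2310 * τ n ²)                             ≡⟨ regroup′ (τ n) ⟩
    9240 * τ n ^ 2                                 ∎
    where
    open ≤-Reasoning
    instance _ = >-nonZero (<-trans z<s 2≤n)
    dc = divisorChains n
    open DivisorChains dc
    t = rankSizes exponents ⌊ sum exponents /2⌋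
    regroup : ∀ t s → (2 * t) * (2 * t) * s ≡ 4 * (t * t * s)
    regroup = solve-∀
    regroup′ : ∀ x → 4 * (2310 * (x * x)) ≡ 9240 * (x * (x * 1))
    regroup′ = solve-∀
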